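{- Let $\mathbb F$ be a field of characteristic $0$. Let $\{\lambda^n/\mu^n\}_{n\ge0}$ be a graded skew partition sequence and for each $n\geq0$ put $u_n=e_{\lambda^n/\mu^n}$. Then the set $\{u_n\}_{n\geq0}$ is algebraically independent over $\mathbb F$ and generates $\Lambda_{\mathbb F}$ as an $\mathbb F$-algebra if and only if, for each $n\geq 1$, $\lambda_1^n\geq n$.
   Context: $\Lambda_{\mathbb F}$ is the ring of symmetric functions in infinitely many variables over $\mathbb F$, $e_\lambda=\prod_i e_{\lambda_i}$ are elementary symmetric functions, and the Hall inner product satisfies $\langle h_\lambda,m_\mu\rangle=\delta_{\lambda\mu}$. A skew partition of $n$ is any pair $(\lambda,\mu)$ of partitions with $|\lambda|-|\mu|=n$, written $\lambda/\mu$ (containment not assumed); a graded skew partition sequence has $\lambda^n/\mu^n$ a skew partition of $n$ for each $n$. The skew elementary function is defined by $\langle e_{\lambda/\mu},f\rangle=\langle e_\lambda,e_\mu f\rangle$ for all $f\in\Lambda_{\mathbb F}$. $\lambda_1^n$ is the largest part of $\lambda^n$. -}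

module Defs where

open import Level using (Level; _⊔_) renaming (suc to lsuc)
open import Algebra.Bundles using (CommutativeRing)
open import Data.Nat as ℕ using (ℕ; zero; suc; _∸_; _≤ᵇ_; _<_; _≥_)
open import Data.Nat.Properties using () renaming (_≟_ to _≟ℕ_)
open import Data.Bool using (Bool; true; false; if_then_else_)
open import Data.List using (List; []; _∷_; _++_; map; concatMap; upTo; zipWith; foldr; filterᵇ; length)
open import Data.List.Properties using (≡-dec)
open import Data.Nat.ListAction using (sum)
open import Data.List.Relation.Unary.All using (All)
open import Data.List.Relation.Unary.Linked using (Linked)
open import Data.Product using (_×_; _,_; ∃)
open import Relation.Nullary using (¬_; does)

record Field (c ℓ : Level) : Set (lsuc (c ⊔ ℓ)) where
  field
    commutativeRing : CommutativeRing c ℓ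
  open CommutativeRing commutativeRing public
  field
    0≉1     : ¬ (0# ≈ 1#)
    inverse : ∀ x → ¬ (x ≈ 0#) → ∃ λ y → (x * y) ≈ 1#

IsPartition : List ℕ → Set
IsPartition l = All (0 <_) l × Linked _≥_ l

size : List ℕ → ℕ
size = sum

largest : List ℕ → ℕ
largest []      = 0
largest (x ∷ _) = x

IsGradedSkewSeq : (ℕ → List ℕ) → (ℕ → List ℕ) → Set
IsGradedSkewSeq lam mu =
  ∀ n → IsPartition (lam n) × IsPartition (mu n) × size (lam n) ≡ n ℕ.+ size (mu n)
  where open import Relation.Binary.PropositionalEquality using (_≡_)

-- Normalisation of finite multisets of naturals (descending sort).

insertD : ℕ → List ℕ → List ℕ
insertD x []       = x ∷ []
insertD x (y ∷ ys) = if y ≤ᵇ x then x ∷ y ∷ ys else y ∷ insertD x ys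

sortD : List ℕ → List ℕ
sortD = foldr insertD []

-- keys of the e-basis: drop zero parts (e₀ = 1) and sort
normE : List ℕ → List ℕ
normE l = sortD (filterᵇ (λ x → 1 ≤ᵇ x) l)

-- Number of ℕ-matrices with row sums λ and column sums μ.
-- This is ⟨h_λ , h_μ⟩ = ⟨e_λ , e_μ⟩ for the Hall inner product.

comps : ℕ → List ℕ → List (List ℕ)
comps zero    []       = [] ∷ []
comps (suc _) []       = []
comps r       (m ∷ ms) =
  concatMap (λ i → map (i ∷_) (comps (r ∸ i) ms))
            (filterᵇ (λ i → i ≤ᵇ r) (upTo (suc m)))

allZero : List ℕ → Bool
allZero []            = true
allZero (zero  ∷ xs)  = allZero xs
allZero (suc _ ∷ _)   = false

matCount : List ℕ → List ℕ → ℕ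
matCount []      μ = if allZero μ then 1 else 0
matCount (r ∷ λ') μ = sum (map (λ c → matCount λ' (zipWith _∸_ μ c)) (comps r μ))

module _ {c ℓ : Level} (F : Field c ℓ) where
  open Field F

  fromℕ : ℕ → Carrier
  fromℕ zero    = 0#
  fromℕ (suc n) = 1# + fromℕ n

  CharZero : Set ℓ
  CharZero = ∀ n → ¬ (fromℕ (suc n) ≈ 0#)

  -- finite formal F-linear combinations of keys (lists of naturals)
  FSum : Set c
  FSum = List (Carrier × List ℕ)

  coeffWith : (List ℕ → List ℕ) → FSum → List ℕ → Carrier
  coeffWith nrm []             ν = 0#
  coeffWith nrm ((a , k) ∷ xs) ν =
    if does (≡-dec _≟ℕ_ (nrm k) ν) then a + coeffWith nrm xs ν else coeffWith nrm xs ν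

  -- Λ_F, presented as F[e₁,e₂,…]: an element Σ aᵢ e_{κᵢ}
  -- (e_κ = Πⱼ e_{κⱼ}, e₀ = 1); two elements are equal iff they have
  -- the same coefficient on every e_ν (ν a partition).

  Λ : Set c
  Λ = FSum

  _≈Λ_ : Λ → Λ → Set ℓ
  f ≈Λ g = ∀ ν → coeffWith normE f ν ≈ coeffWith normE g ν

  0Λ : Λ
  0Λ = []

  1Λ : Λ
  1Λ = (1# , []) ∷ []

  _+Λ_ : Λ → Λ → Λ
  f +Λ g = f ++ g

  _*Λ_ : Λ → Λ → Λ
  f *Λ g = concatMap (λ { (a , k) → map (λ { (b , l) → (a * b , k ++ l) }) g }) f

  _•Λ_ : Carrier → Λ → Λ
  a •Λ f = map (λ { (b , k) → (a * b , k) }) f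

  eΛ : List ℕ → Λ
  eΛ κ = (1# , κ) ∷ []

  -- Hall inner product (bilinear), via ⟨e_κ , e_ρ⟩ = ⟨h_κ , h_ρ⟩ = matCount κ ρ
  ⟨_,_⟩ : Λ → Λ → Carrier
  ⟨ f , g ⟩ = foldr _+_ 0#
    (concatMap (λ { (a , k) → map (λ { (b , l) → a * b * fromℕ (matCount k l) }) g }) f)

  IsSkewE : List ℕ → List ℕ → Λ → Set (c ⊔ ℓ)
  IsSkewE lam mu u = ∀ f → ⟨ u , f ⟩ ≈ ⟨ eΛ lam , eΛ mu *Λ f ⟩

  -- Polynomials over F in variables x₀, x₁, …: Σ aᵢ x_{kᵢ} (x_k = Πⱼ x_{kⱼ})

  Poly : Set c
  Poly = FSum

  coeffP : Poly → List ℕ → Carrier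
  coeffP = coeffWith sortD

  IsZeroPoly : Poly → Set ℓ
  IsZeroPoly P = ∀ k → coeffP P k ≈ 0#

  prodΛ : List Λ → Λ
  prodΛ = foldr _*Λ_ 1Λ

  eval : (ℕ → Λ) → Poly → Λ
  eval v P = concatMap (λ { (a , k) → a •Λ prodΛ (map v k) }) P

  AlgIndependent : (ℕ → Λ) → Set (c ⊔ ℓ)
  AlgIndependent v = ∀ P → eval v P ≈Λ 0Λ → IsZeroPoly P

  Generates : (ℕ → Λ) → Set (c ⊔ ℓ)
  Generates v = ∀ f → ∃ λ P → eval v P ≈Λ f

{-# OPTIONS --safe #-}
module Submission where

-- In characteristic 0 the Hall pairing is nondegenerate (pairing with the power-sum products p_ν
-- is triangular in the number of parts), so e_{λ/μ} = Σ e_κ over the row sums κ left after filling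
-- the columns μ of a matrix with row sums λ. Hence uₙ = αₙ eₙ + (terms in e_j, j < n), where αₙ
-- counts the κ of the form (n, 0, …, 0) and is positive exactly when λ₁ⁿ ≥ n. If every αₙ ≠ 0 the
-- uₙ are a triangular change of free generators of F[e₁, e₂, …]. If αₙ = 0, no generator has an
-- eₙ-term; reading off the eₙ-coefficient is a derivation at the augmentation, so nothing in the
-- algebra they generate has one, and eₙ is not generated.

open import Defs
open import Data.Nat using (ℕ; suc; _≥_)
open import Data.Nat using (_≤_)
open import Data.Product using (_×_)
open import Data.List using (List)
open import Function.Bundles using (_⇔_)
open import Algebra.Bundles using (CommutativeSemiring)

module BoolComparison where

  open import Data.Nat using (zero; suc; _≤ᵇ_; _≤_; _+_; _∸_)
  open import Data.Nat.Properties
  open import Data.Bool using (true; false; T; not; _∧_)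
  open import Data.Bool.Properties using (T-≡; T-not-≡)
  open import Function.Bundles using (Equivalence)
  open import Data.Empty using (⊥-elim)
  open import Relation.Binary.PropositionalEquality
  open import Relation.Nullary using (¬_)

  T⇒≡true : ∀ {b} → T b → b ≡ true
  T⇒≡true = Equivalence.to T-≡

  T-not⇒≡false : ∀ {b} → T (not b) → b ≡ false
  T-not⇒≡false = Equivalence.to T-not-≡

  ≤ᵇ-true⇒≤ : ∀ m n → (m ≤ᵇ n) ≡ true → m ≤ n
  ≤ᵇ-true⇒≤ m n e = ≤ᵇ⇒≤ m n (subst T (sym e) _)

  ≤ᵇ-false⇒≰ : ∀ m n → (m ≤ᵇ n) ≡ false → ¬ (m ≤ n)
  ≤ᵇ-false⇒≰ m n e m≤n = subst T e (≤⇒≤ᵇ m≤n)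

  ≤⇒≤ᵇ-true : ∀ {m n} → m ≤ n → (m ≤ᵇ n) ≡ true
  ≤⇒≤ᵇ-true {m} {n} m≤n with m ≤ᵇ n in e
  ... | true  = refl
  ... | false = ⊥-elim (≤ᵇ-false⇒≰ m n e m≤n)

  ≰⇒≤ᵇ-false : ∀ {m n} → ¬ (m ≤ n) → (m ≤ᵇ n) ≡ false
  ≰⇒≤ᵇ-false {m} {n} m≰n with m ≤ᵇ n in e
  ... | true  = ⊥-elim (m≰n (≤ᵇ-true⇒≤ m n e))
  ... | false = refl

  ≤ᵇ-suc : ∀ m n → (suc m ≤ᵇ suc n) ≡ (m ≤ᵇ n)
  ≤ᵇ-suc zero    n = refl
  ≤ᵇ-suc (suc m) n = refl

  ≤ᵇ∧≤ᵇ∸≡+≤ᵇ : ∀ x y r → ((x ≤ᵇ r) ∧ (y ≤ᵇ r ∸ x)) ≡ (x + y ≤ᵇ r)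
  ≤ᵇ∧≤ᵇ∸≡+≤ᵇ x y r with x ≤ᵇ r in e₁
  ... | false = sym (≰⇒≤ᵇ-false λ x+y≤r → ≤ᵇ-false⇒≰ x r e₁ (≤-trans (m≤m+n x y) x+y≤r))
  ... | true with y ≤ᵇ r ∸ x in e₂
  ...   | true  = sym (≤⇒≤ᵇ-true (subst (x + y ≤_) (m+[n∸m]≡n (≤ᵇ-true⇒≤ x r e₁))
                                              (+-monoʳ-≤ x (≤ᵇ-true⇒≤ y (r ∸ x) e₂))))
  ...   | false = sym (≰⇒≤ᵇ-false λ x+y≤r →
                    ≤ᵇ-false⇒≰ y (r ∸ x) e₂ (subst (_≤ r ∸ x) (m+n∸m≡n x y) (∸-monoˡ-≤ x x+y≤r)))

  ≤ᵇ∧≤ᵇ∸-comm : ∀ x y r → ((x ≤ᵇ r) ∧ (y ≤ᵇ r ∸ x)) ≡ ((y ≤ᵇ r) ∧ (x ≤ᵇ r ∸ y))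
  ≤ᵇ∧≤ᵇ∸-comm x y r =
    trans (≤ᵇ∧≤ᵇ∸≡+≤ᵇ x y r) (trans (cong (_≤ᵇ r) (+-comm x y)) (sym (≤ᵇ∧≤ᵇ∸≡+≤ᵇ y x r)))

module Compositions where

  open import Data.Nat using (ℕ; zero; suc; _+_; _∸_; _≤ᵇ_; _≤_; _⊓_; s≤s)
  open import Data.Nat.Properties
  open import Data.Nat.ListAction using (sum)
  open import Data.List using (List; []; _∷_; _++_; map; concatMap; filterᵇ; upTo; zipWith)
  open import Data.List.Properties using (upTo-∷ʳ; ++-identityʳ; filter-++)
  open import Data.List.Relation.Unary.All as All using (All; []; _∷_)
  open import Data.List.Relation.Unary.All.Properties using (applyUpTo⁺₁; map⁺; concat⁺)
  open import Data.List.Relation.Binary.Pointwise using (Pointwise; []; _∷_)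
  open import Data.List.Membership.Propositional using (_∈_; lose)
  open import Data.List.Membership.Propositional.Properties using (∈-map⁺; ∈-concatMap⁺; ∈-upTo⁺)
  open import Data.List.Relation.Unary.Any using (here)
  open import Data.Bool using (true; false)
  open import Data.Product using (_×_; _,_)
  open import Function using (_∘_; id)
  open import Relation.Nullary.Decidable using (T?)
  open import Relation.Binary.PropositionalEquality
  open BoolComparison

  range : ℕ → ℕ → List ℕ
  range m r = filterᵇ (_≤ᵇ r) (upTo (suc m))

  comps-∷ : ∀ r m ms → comps r (m ∷ ms) ≡ concatMap (λ i → map (i ∷_) (comps (r ∸ i) ms)) (range m r)
  comps-∷ zero    m ms = refl
  comps-∷ (suc r) m ms = refl

  range≡upTo : ∀ m r → range m r ≡ upTo (suc (m ⊓ r))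
  range≡upTo zero    r = refl
  range≡upTo (suc m) r = begin
    filterᵇ (_≤ᵇ r) (upTo (suc (suc m)))              ≡⟨ cong (filterᵇ (_≤ᵇ r)) (sym (upTo-∷ʳ (suc m))) ⟩
    filterᵇ (_≤ᵇ r) (upTo (suc m) ++ suc m ∷ [])      ≡⟨ filter-++ (T? ∘ (_≤ᵇ r)) (upTo (suc m)) (suc m ∷ []) ⟩
    range m r ++ filterᵇ (_≤ᵇ r) (suc m ∷ [])         ≡⟨ cong (_++ filterᵇ (_≤ᵇ r) (suc m ∷ [])) (range≡upTo m r) ⟩
    upTo (suc (m ⊓ r)) ++ filterᵇ (_≤ᵇ r) (suc m ∷ []) ≡⟨ last-step ⟩
    upTo (suc (suc m ⊓ r))                            ∎
    where
    open ≡-Reasoning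
    last-step : upTo (suc (m ⊓ r)) ++ filterᵇ (_≤ᵇ r) (suc m ∷ []) ≡ upTo (suc (suc m ⊓ r))
    last-step with suc m ≤ᵇ r in e
    ... | true  = extend (≤ᵇ-true⇒≤ (suc m) r e)
      where
      extend : suc m ≤ r → upTo (suc (m ⊓ r)) ++ suc m ∷ [] ≡ upTo (suc (suc m ⊓ r))
      extend m<r rewrite m≤n⇒m⊓n≡m m<r | m≤n⇒m⊓n≡m (<⇒≤ m<r) = upTo-∷ʳ (suc m)
    ... | false = keep (≮⇒≥ (≤ᵇ-false⇒≰ (suc m) r e))
      where
      keep : r ≤ m → upTo (suc (m ⊓ r)) ++ [] ≡ upTo (suc (suc m ⊓ r))
      keep r≤m rewrite m≥n⇒m⊓n≡n r≤m | m≥n⇒m⊓n≡n (m≤n⇒m≤1+n r≤m) = ++-identityʳ _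

  range-sym : ∀ m r → range m r ≡ range r m
  range-sym m r = trans (range≡upTo m r) (trans (cong (upTo ∘ suc) (⊓-comm m r)) (sym (range≡upTo r m)))

  range-bounded : ∀ m r → All (λ i → i ≤ m × i ≤ r) (range m r)
  range-bounded m r rewrite range≡upTo m r =
    applyUpTo⁺₁ id (suc (m ⊓ r)) λ i<1+m⊓r → let i≤m⊓r = ≤-pred i<1+m⊓r in
      ≤-trans i≤m⊓r (m⊓n≤m m r) , ≤-trans i≤m⊓r (m⊓n≤n m r)

  ∈-range : ∀ {i m r} → i ≤ m → i ≤ r → i ∈ range m r
  ∈-range {i} {m} {r} i≤m i≤r rewrite range≡upTo m r = ∈-upTo⁺ (s≤s (⊓-glb i≤m i≤r))

  IsComposition : ℕ → List ℕ → List ℕ → Set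
  IsComposition r caps s = Pointwise _≤_ s caps × sum s ≡ r

  comps-sound : ∀ r caps → All (IsComposition r caps) (comps r caps)
  comps-sound zero    []       = ([] , refl) ∷ []
  comps-sound (suc r) []       = []
  comps-sound r       (m ∷ ms) rewrite comps-∷ r m ms =
    concat⁺ (map⁺ (All.map (λ {i} → extend i) (range-bounded m r)))
    where
    extend : ∀ i → i ≤ m × i ≤ r → All (IsComposition r (m ∷ ms)) (map (i ∷_) (comps (r ∸ i) ms))
    extend i (i≤m , i≤r) = map⁺ (All.map (λ (s≤ms , Σs) → i≤m ∷ s≤ms , trans (cong (i +_) Σs) (m+[n∸m]≡n i≤r))
                                         (comps-sound (r ∸ i) ms))

  comps-complete : ∀ {s κ} → Pointwise _≤_ s κ → s ∈ comps (sum s) κ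
  comps-complete []                           = here refl
  comps-complete {x ∷ s} {m ∷ ms} (x≤m ∷ s≤ms) rewrite comps-∷ (x + sum s) m ms =
    ∈-concatMap⁺ (λ i → map (i ∷_) (comps (x + sum s ∸ i) ms)) (lose (∈-range x≤m (m≤m+n x (sum s)))
      (∈-map⁺ (x ∷_) (subst (λ r → s ∈ comps r ms) (sym (m+n∸m≡n x (sum s))) (comps-complete s≤ms))))

  zeros : List ℕ → List ℕ
  zeros = map (λ _ → 0)

  comps-0 : ∀ ρ → comps 0 ρ ≡ zeros ρ ∷ []
  comps-0 []       = refl
  comps-0 (m ∷ ms) = begin
    concatMap (λ i → map (i ∷_) (comps (0 ∸ i) ms)) (range m 0) ≡⟨ cong (concatMap _) range-0 ⟩
    map (0 ∷_) (comps 0 ms) ++ []                              ≡⟨ ++-identityʳ _ ⟩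
    map (0 ∷_) (comps 0 ms)                                    ≡⟨ cong (map (0 ∷_)) (comps-0 ms) ⟩
    (0 ∷ zeros ms) ∷ []                                         ∎
    where
    open ≡-Reasoning
    range-0 : range m 0 ≡ 0 ∷ []
    range-0 = trans (range≡upTo m 0) (cong (upTo ∘ suc) (⊓-zeroʳ m))

  zipWith-∸-zeros : ∀ ρ → zipWith _∸_ ρ (zeros ρ) ≡ ρ
  zipWith-∸-zeros []      = refl
  zipWith-∸-zeros (x ∷ ρ) = cong (x ∷_) (zipWith-∸-zeros ρ)

module FiniteSum {a ℓ} (S : CommutativeSemiring a ℓ) where

  open import Data.Nat as ℕ using (ℕ; zero; suc; _∸_; _≤ᵇ_)
  import Data.Nat.Properties as ℕP
  open import Data.Bool using (Bool; true; false; if_then_else_; not; _∧_)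
  open import Data.List using (List; []; _∷_; _++_; _∷ʳ_; map; concatMap; foldr; filterᵇ; upTo)
  open import Data.List.Properties using (map-applyUpTo; upTo-∷ʳ)
  open import Data.List.Relation.Unary.All using (All; []; _∷_)
  open import Data.List.Relation.Unary.All.Properties using (applyUpTo⁺₁)
  open import Function using (_∘_; id)
  import Relation.Binary.PropositionalEquality as P
  open P using (_≡_)
  open BoolComparison using (≤ᵇ∧≤ᵇ∸-comm; ≤ᵇ-suc)
  open Compositions using (range; comps-∷)
  open CommutativeSemiring S hiding (zero)
  open import Relation.Binary.Reasoning.Setoid setoid

  ∑ : ∀ {b} {A : Set b} → List A → (A → Carrier) → Carrier
  ∑ xs f = foldr _+_ 0# (map f xs)

  module _ {b} {A : Set b} where

    ∑-cong : ∀ (xs : List A) {f g : A → Carrier} → (∀ x → f x ≈ g x) → ∑ xs f ≈ ∑ xs g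
    ∑-cong []       f≈g = refl
    ∑-cong (x ∷ xs) f≈g = +-cong (f≈g x) (∑-cong xs f≈g)

    ∑-cong-All : ∀ {xs : List A} {f g : A → Carrier} → All (λ x → f x ≈ g x) xs → ∑ xs f ≈ ∑ xs g
    ∑-cong-All []         = refl
    ∑-cong-All (e ∷ es) = +-cong e (∑-cong-All es)

    ∑-zero : ∀ (xs : List A) {f : A → Carrier} → (∀ x → f x ≈ 0#) → ∑ xs f ≈ 0#
    ∑-zero []       f≈0 = refl
    ∑-zero (x ∷ xs) f≈0 = trans (+-cong (f≈0 x) (∑-zero xs f≈0)) (+-identityˡ _)

    ∑-zero-All : ∀ {xs : List A} {f : A → Carrier} → All (λ x → f x ≈ 0#) xs → ∑ xs f ≈ 0#
    ∑-zero-All []       = refl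
    ∑-zero-All (e ∷ es) = trans (+-cong e (∑-zero-All es)) (+-identityˡ _)

    ∑-++ : ∀ (xs ys : List A) (f : A → Carrier) → ∑ (xs ++ ys) f ≈ ∑ xs f + ∑ ys f
    ∑-++ []       ys f = sym (+-identityˡ _)
    ∑-++ (x ∷ xs) ys f = trans (+-cong refl (∑-++ xs ys f)) (sym (+-assoc _ _ _))

    ∑-+ : ∀ (xs : List A) (f g : A → Carrier) → ∑ xs (λ x → f x + g x) ≈ ∑ xs f + ∑ xs g
    ∑-+ []       f g = sym (+-identityˡ _)
    ∑-+ (x ∷ xs) f g = begin
      (f x + g x) + ∑ xs (λ x → f x + g x) ≈⟨ +-cong refl (∑-+ xs f g) ⟩
      (f x + g x) + (∑ xs f + ∑ xs g)      ≈⟨ +-assoc _ _ _ ⟩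
      f x + (g x + (∑ xs f + ∑ xs g))      ≈⟨ +-cong refl (sym (+-assoc _ _ _)) ⟩
      f x + ((g x + ∑ xs f) + ∑ xs g)      ≈⟨ +-cong refl (+-cong (+-comm _ _) refl) ⟩
      f x + ((∑ xs f + g x) + ∑ xs g)      ≈⟨ +-cong refl (+-assoc _ _ _) ⟩
      f x + (∑ xs f + (g x + ∑ xs g))      ≈⟨ sym (+-assoc _ _ _) ⟩
      (f x + ∑ xs f) + (g x + ∑ xs g)      ∎

    ∑-*ˡ : ∀ (xs : List A) (c : Carrier) (f : A → Carrier) → ∑ xs (λ x → c * f x) ≈ c * ∑ xs f
    ∑-*ˡ []       c f = sym (zeroʳ c)
    ∑-*ˡ (x ∷ xs) c f = trans (+-cong refl (∑-*ˡ xs c f)) (sym (distribˡ c _ _))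

    ∑-*ʳ : ∀ (xs : List A) (c : Carrier) (f : A → Carrier) → ∑ xs (λ x → f x * c) ≈ ∑ xs f * c
    ∑-*ʳ []       c f = sym (zeroˡ c)
    ∑-*ʳ (x ∷ xs) c f = trans (+-cong refl (∑-*ʳ xs c f)) (sym (distribʳ c _ _))

    ∑-partition : ∀ (p : A → Bool) (xs : List A) f →
                  ∑ xs f ≈ ∑ (filterᵇ p xs) f + ∑ (filterᵇ (not ∘ p) xs) f
    ∑-partition p []       f = sym (+-identityˡ _)
    ∑-partition p (x ∷ xs) f with p x
    ... | true  = trans (+-cong refl (∑-partition p xs f)) (sym (+-assoc _ _ _))
    ... | false = begin
      f x + ∑ xs f                           ≈⟨ +-cong refl (∑-partition p xs f) ⟩
      f x + (∑ xs⁺ f + ∑ xs⁻ f)              ≈⟨ sym (+-assoc _ _ _) ⟩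
      (f x + ∑ xs⁺ f) + ∑ xs⁻ f              ≈⟨ +-cong (+-comm _ _) refl ⟩
      (∑ xs⁺ f + f x) + ∑ xs⁻ f              ≈⟨ +-assoc _ _ _ ⟩
      ∑ xs⁺ f + (f x + ∑ xs⁻ f)              ∎
      where xs⁺ = filterᵇ p xs
            xs⁻ = filterᵇ (not ∘ p) xs

  module _ {b c} {A : Set b} {B : Set c} where

    ∑-map : ∀ (xs : List A) (h : A → B) (f : B → Carrier) → ∑ (map h xs) f ≡ ∑ xs (f ∘ h)
    ∑-map []       h f = P.refl
    ∑-map (x ∷ xs) h f = P.cong (f (h x) +_) (∑-map xs h f)

    ∑-concatMap : ∀ (xs : List A) (g : A → List B) (f : B → Carrier) →
                  ∑ (concatMap g xs) f ≈ ∑ xs (λ x → ∑ (g x) f)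
    ∑-concatMap []       g f = refl
    ∑-concatMap (x ∷ xs) g f = trans (∑-++ (g x) (concatMap g xs) f) (+-cong refl (∑-concatMap xs g f))

    ∑-swap : ∀ (xs : List A) (ys : List B) (f : A → B → Carrier) →
             ∑ xs (λ x → ∑ ys (f x)) ≈ ∑ ys (λ y → ∑ xs (λ x → f x y))
    ∑-swap []       ys f = sym (∑-zero ys (λ _ → refl))
    ∑-swap (x ∷ xs) ys f = begin
      ∑ ys (f x) + ∑ xs (λ x → ∑ ys (f x))          ≈⟨ +-cong refl (∑-swap xs ys f) ⟩
      ∑ ys (f x) + ∑ ys (λ y → ∑ xs (λ x → f x y))  ≈⟨ sym (∑-+ ys (f x) _) ⟩
      ∑ ys (λ y → f x y + ∑ xs (λ x → f x y))        ∎

  ∑-upTo-suc : ∀ n (f : ℕ → Carrier) → ∑ (upTo (suc n)) f ≈ f 0 + ∑ (upTo n) (f ∘ suc)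
  ∑-upTo-suc n f = +-cong refl (reflexive (P.trans
    (P.cong (λ l → ∑ l f) (P.sym (map-applyUpTo id suc n))) (∑-map (upTo n) suc f)))

  ∑-upTo-∷ʳ : ∀ n (f : ℕ → Carrier) → ∑ (upTo (suc n)) f ≈ ∑ (upTo n) f + f n
  ∑-upTo-∷ʳ n f = begin
    ∑ (upTo (suc n)) f      ≡⟨ P.cong (λ l → ∑ l f) (P.sym (upTo-∷ʳ n)) ⟩
    ∑ (upTo n ∷ʳ n) f       ≈⟨ ∑-++ (upTo n) (n ∷ []) f ⟩
    ∑ (upTo n) f + (f n + 0#) ≈⟨ +-cong refl (+-identityʳ _) ⟩
    ∑ (upTo n) f + f n      ∎

  when : Bool → Carrier → Carrier
  when b v = if b then v else 0#

  when-0 : ∀ b → when b 0# ≈ 0#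
  when-0 true  = refl
  when-0 false = refl

  when-1* : ∀ b v → when b 1# * v ≈ when b v
  when-1* true  v = *-identityˡ v
  when-1* false v = zeroˡ v

  when-cong : ∀ b {v w} → v ≈ w → when b v ≈ when b w
  when-cong true  v≈w = v≈w
  when-cong false v≈w = refl

  when-∧ : ∀ b₁ b₂ v → when b₁ (when b₂ v) ≡ when (b₁ ∧ b₂) v
  when-∧ true  b₂ v = P.refl
  when-∧ false b₂ v = P.refl

  when-∑ : ∀ {b} {A : Set b} b₁ (xs : List A) f → when b₁ (∑ xs f) ≈ ∑ xs (λ x → when b₁ (f x))
  when-∑ true  xs f = refl
  when-∑ false xs f = sym (∑-zero xs (λ _ → refl))

  ∑-filter : ∀ {b} {A : Set b} (p : A → Bool) (xs : List A) f →
             ∑ (filterᵇ p xs) f ≈ ∑ xs (λ x → when (p x) (f x))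
  ∑-filter p []       f = refl
  ∑-filter p (x ∷ xs) f with p x
  ... | true  = +-cong refl (∑-filter p xs f)
  ... | false = trans (∑-filter p xs f) (sym (+-identityˡ _))

  ∑-range : ∀ m r (f : ℕ → Carrier) → ∑ (range m r) f ≈ ∑ (upTo (suc m)) (λ i → when (i ≤ᵇ r) (f i))
  ∑-range m r f = ∑-filter (_≤ᵇ r) (upTo (suc m)) f

  ∑-comps : ∀ r m ms (f : List ℕ → Carrier) →
            ∑ (comps r (m ∷ ms)) f ≈ ∑ (range m r) (λ i → ∑ (comps (r ∸ i) ms) (λ s → f (i ∷ s)))
  ∑-comps r m ms f rewrite comps-∷ r m ms =
    trans (∑-concatMap (range m r) (λ i → map (i ∷_) (comps (r ∸ i) ms)) f)
          (∑-cong (range m r) (λ i → reflexive (∑-map (comps (r ∸ i) ms) (i ∷_) f)))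

  ∑-range-swap : ∀ a b r (f : ℕ → ℕ → Carrier) →
    ∑ (range a r) (λ x → ∑ (range b (r ∸ x)) (f x)) ≈ ∑ (range b r) (λ y → ∑ (range a (r ∸ y)) (λ x → f x y))
  ∑-range-swap a b r f = begin
    ∑ (range a r) (λ x → ∑ (range b (r ∸ x)) (f x))
      ≈⟨ ∑-range a r _ ⟩
    ∑ A (λ x → when (x ≤ᵇ r) (∑ (range b (r ∸ x)) (f x)))
      ≈⟨ ∑-cong A (λ x → when-cong (x ≤ᵇ r) (∑-range b (r ∸ x) (f x))) ⟩
    ∑ A (λ x → when (x ≤ᵇ r) (∑ B (λ y → when (y ≤ᵇ r ∸ x) (f x y))))
      ≈⟨ ∑-cong A (λ x → when-∑ (x ≤ᵇ r) B _) ⟩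
    ∑ A (λ x → ∑ B (λ y → when (x ≤ᵇ r) (when (y ≤ᵇ r ∸ x) (f x y))))
      ≈⟨ ∑-cong A (λ x → ∑-cong B (λ y → reflexive (both-bounds x y))) ⟩
    ∑ A (λ x → ∑ B (λ y → when (y ≤ᵇ r) (when (x ≤ᵇ r ∸ y) (f x y))))
      ≈⟨ ∑-swap A B _ ⟩
    ∑ B (λ y → ∑ A (λ x → when (y ≤ᵇ r) (when (x ≤ᵇ r ∸ y) (f x y))))
      ≈⟨ ∑-cong B (λ y → when-∑ (y ≤ᵇ r) A _) ⟨
    ∑ B (λ y → when (y ≤ᵇ r) (∑ A (λ x → when (x ≤ᵇ r ∸ y) (f x y))))
      ≈⟨ ∑-cong B (λ y → when-cong (y ≤ᵇ r) (∑-range a (r ∸ y) (λ x → f x y))) ⟨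
    ∑ B (λ y → when (y ≤ᵇ r) (∑ (range a (r ∸ y)) (λ x → f x y)))
      ≈⟨ ∑-range b r _ ⟨
    ∑ (range b r) (λ y → ∑ (range a (r ∸ y)) (λ x → f x y)) ∎
    where
    A = upTo (suc a)
    B = upTo (suc b)
    both-bounds : ∀ x y → when (x ≤ᵇ r) (when (y ≤ᵇ r ∸ x) (f x y)) ≡ when (y ≤ᵇ r) (when (x ≤ᵇ r ∸ y) (f x y))
    both-bounds x y = P.trans (when-∧ (x ≤ᵇ r) _ _)
                     (P.trans (P.cong (λ b → when b (f x y)) (≤ᵇ∧≤ᵇ∸-comm x y r)) (P.sym (when-∧ (y ≤ᵇ r) _ _)))

  -- The substitution y = x + i.
  ∑-shift : ∀ i k q (h : ℕ → Carrier) →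
    ∑ (upTo (suc k)) (λ x → when (x ≤ᵇ q) (when (i ≤ᵇ k ∸ x) (h (x ℕ.+ i)))) ≈
    ∑ (upTo (suc k)) (λ y → when (y ≤ᵇ q ℕ.+ i) (when (i ≤ᵇ y) (h y)))
  ∑-shift zero    k       q h = ∑-cong (upTo (suc k)) (λ x →
    reflexive (P.cong₂ (λ a b → when (x ≤ᵇ a) (h b)) (P.sym (ℕP.+-identityʳ q)) (ℕP.+-identityʳ x)))
  ∑-shift (suc i) zero    q h = refl
  ∑-shift (suc i) (suc k) q h = begin
    ∑ (upTo (suc (suc k))) lhs
      ≈⟨ ∑-upTo-∷ʳ (suc k) lhs ⟩
    ∑ (upTo (suc k)) lhs + lhs (suc k)
      ≈⟨ +-cong (∑-cong-All (applyUpTo⁺₁ id (suc k) lhs-lower)) (reflexive lhs-last) ⟩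
    ∑ (upTo (suc k)) (λ x → when (x ≤ᵇ q) (when (i ≤ᵇ k ∸ x) (h (suc (x ℕ.+ i))))) + when (suc k ≤ᵇ q) 0#
      ≈⟨ +-cong (∑-shift i k q (h ∘ suc)) (when-0 _) ⟩
    ∑ (upTo (suc k)) (λ y → when (y ≤ᵇ q ℕ.+ i) (when (i ≤ᵇ y) (h (suc y)))) + 0#
      ≈⟨ +-comm _ _ ⟩
    0# + ∑ (upTo (suc k)) (λ y → when (y ≤ᵇ q ℕ.+ i) (when (i ≤ᵇ y) (h (suc y))))
      ≈⟨ +-cong (when-0 (0 ≤ᵇ q ℕ.+ suc i)) (∑-cong (upTo (suc k)) (reflexive ∘ rhs-suc)) ⟨
    rhs 0 + ∑ (upTo (suc k)) (rhs ∘ suc)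
      ≈⟨ ∑-upTo-suc (suc k) rhs ⟨
    ∑ (upTo (suc (suc k))) rhs
      ∎
    where
    lhs rhs : ℕ → Carrier
    lhs x = when (x ≤ᵇ q) (when (suc i ≤ᵇ suc k ∸ x) (h (x ℕ.+ suc i)))
    rhs y = when (y ≤ᵇ q ℕ.+ suc i) (when (suc i ≤ᵇ y) (h y))
    lhs-lower : ∀ {x} → x ℕ.< suc k → lhs x ≈ when (x ≤ᵇ q) (when (i ≤ᵇ k ∸ x) (h (suc (x ℕ.+ i))))
    lhs-lower {x} x<1+k = reflexive (P.cong₂ (λ a b → when (x ≤ᵇ q) (when a (h b)))
      (P.trans (P.cong (suc i ≤ᵇ_) (ℕP.+-∸-assoc 1 (ℕP.≤-pred x<1+k))) (≤ᵇ-suc i (k ∸ x))) (ℕP.+-suc x i))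
    lhs-last : lhs (suc k) ≡ when (suc k ≤ᵇ q) 0#
    lhs-last = P.cong (λ a → when (suc k ≤ᵇ q) (when (suc i ≤ᵇ a) (h (suc k ℕ.+ suc i)))) (ℕP.n∸n≡0 k)
    rhs-suc : ∀ y → rhs (suc y) ≡ when (y ≤ᵇ q ℕ.+ i) (when (i ≤ᵇ y) (h (suc y)))
    rhs-suc y = P.cong₂ (λ a b → when a (when b (h (suc y))))
      (P.trans (P.cong (suc y ≤ᵇ_) (ℕP.+-suc q i)) (≤ᵇ-suc y (q ℕ.+ i))) (≤ᵇ-suc i y)

module Sorting where

  open import Data.Nat using (ℕ; _≤ᵇ_; _≤_)
  open import Data.Nat.Properties using (≤-antisym; ≤-trans; ≤-total; ≤ᵇ⇒≤; ≤⇒≤ᵇ)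
  open import Data.List using (List; []; _∷_; _++_; filterᵇ; length)
  open import Data.List.Properties using (filter-++; filter-idem; filter-all)
  open import Data.List.Relation.Binary.Permutation.Propositional as Perm using (_↭_; ↭-sym; ↭-trans; ↭-refl; ↭-reflexive)
  open import Data.List.Relation.Binary.Permutation.Propositional.Properties using (++⁺; ++-comm; filter-↭; ↭-length; All-resp-↭)
  open import Data.List.Relation.Unary.All as All using (All)
  open import Data.List.Relation.Unary.All.Properties using (all-filter) renaming (++⁺ to All-++⁺)
  open import Data.Bool using (Bool; true; false)
  open import Data.Empty using (⊥-elim)
  open import Data.Sum using (inj₁; inj₂)
  open import Function using (_∘_)
  open import Relation.Binary.PropositionalEquality
  open import Relation.Nullary.Decidable using (T?)
  open BoolComparison

  insertD-↭ : ∀ x l → insertD x l ↭ x ∷ l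
  insertD-↭ x []       = ↭-refl
  insertD-↭ x (y ∷ ys) with y ≤ᵇ x
  ... | true  = ↭-refl
  ... | false = ↭-trans (Perm.prep y (insertD-↭ x ys)) (Perm.swap y x ↭-refl)

  sortD-↭ : ∀ l → sortD l ↭ l
  sortD-↭ []      = ↭-refl
  sortD-↭ (x ∷ l) = ↭-trans (insertD-↭ x (sortD l)) (Perm.prep x (sortD-↭ l))

  private
    ≤ᵇ-false-flip : ∀ x y → (x ≤ᵇ y) ≡ false → y ≤ x
    ≤ᵇ-false-flip x y e with ≤-total y x
    ... | inj₁ y≤x = y≤x
    ... | inj₂ x≤y = ⊥-elim (≤ᵇ-false⇒≰ x y e x≤y)

    ≤ᵇ-true-antisym : ∀ x y → (y ≤ᵇ x) ≡ true → (x ≤ᵇ y) ≡ true → x ≡ y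
    ≤ᵇ-true-antisym x y c d = ≤-antisym (≤ᵇ-true⇒≤ x y d) (≤ᵇ-true⇒≤ y x c)

  insertD-comm : ∀ x y l → insertD x (insertD y l) ≡ insertD y (insertD x l)
  insertD-comm x y [] with y ≤ᵇ x in c | x ≤ᵇ y in d
  ... | true  | true  = cong₂ (λ a b → a ∷ b ∷ []) (≤ᵇ-true-antisym x y c d) (sym (≤ᵇ-true-antisym x y c d))
  ... | true  | false = refl
  ... | false | true  = refl
  ... | false | false = ⊥-elim (≤ᵇ-false⇒≰ y x c (≤ᵇ-false-flip x y d))
  insertD-comm x y (z ∷ zs) with z ≤ᵇ x in a | z ≤ᵇ y in b
  ... | false | false rewrite a | b = cong (z ∷_) (insertD-comm x y zs)
  ... | true  | false rewrite a | b with x ≤ᵇ y in d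
  ...   | true  = ⊥-elim (≤ᵇ-false⇒≰ z y b (≤-trans (≤ᵇ-true⇒≤ z x a) (≤ᵇ-true⇒≤ x y d)))
  ...   | false = refl
  insertD-comm x y (z ∷ zs) | false | true rewrite a | b with y ≤ᵇ x in c
  ...   | true  = ⊥-elim (≤ᵇ-false⇒≰ z x a (≤-trans (≤ᵇ-true⇒≤ z y b) (≤ᵇ-true⇒≤ y x c)))
  ...   | false = refl
  insertD-comm x y (z ∷ zs) | true | true rewrite a | b with y ≤ᵇ x in c | x ≤ᵇ y in d
  ...   | true  | true  = cong₂ (λ a b → a ∷ b ∷ z ∷ zs) (≤ᵇ-true-antisym x y c d) (sym (≤ᵇ-true-antisym x y c d))
  ...   | true  | false = refl
  ...   | false | true  = refl
  ...   | false | false = ⊥-elim (≤ᵇ-false⇒≰ y x c (≤ᵇ-false-flip x y d))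

  sortD-resp-↭ : ∀ {l l′} → l ↭ l′ → sortD l ≡ sortD l′
  sortD-resp-↭ Perm.refl                       = refl
  sortD-resp-↭ (Perm.prep x p)                 = cong (insertD x) (sortD-resp-↭ p)
  sortD-resp-↭ (Perm.swap {l} {l′} x y p)      =
    trans (cong (λ q → insertD x (insertD y q)) (sortD-resp-↭ p)) (insertD-comm x y (sortD l′))
  sortD-resp-↭ (Perm.trans p q)                = trans (sortD-resp-↭ p) (sortD-resp-↭ q)

  sortD-idem : ∀ l → sortD (sortD l) ≡ sortD l
  sortD-idem l = sortD-resp-↭ (sortD-↭ l)

  sortD-++ : ∀ k l → sortD (k ++ l) ≡ sortD (sortD k ++ sortD l)
  sortD-++ k l = sortD-resp-↭ (↭-sym (++⁺ (sortD-↭ k) (sortD-↭ l)))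

  positive : ℕ → Bool
  positive x = 1 ≤ᵇ x

  normE-resp-↭ : ∀ {k l} → k ↭ l → normE k ≡ normE l
  normE-resp-↭ p = sortD-resp-↭ (filter-↭ (T? ∘ positive) p)

  normE-↭ : ∀ k → normE k ↭ filterᵇ positive k
  normE-↭ k = sortD-↭ (filterᵇ positive k)

  normE-idem : ∀ k → normE (normE k) ≡ normE k
  normE-idem k = sortD-resp-↭ (↭-trans (filter-↭ (T? ∘ positive) (normE-↭ k))
                                        (↭-reflexive (filter-idem (T? ∘ positive) k)))

  normE-++ : ∀ k l → normE (k ++ l) ≡ sortD (normE k ++ normE l)
  normE-++ k l = trans (cong sortD (filter-++ (T? ∘ positive) k l)) (sortD-resp-↭ (↭-sym (++⁺ (normE-↭ k) (normE-↭ l))))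

  normE-comm : ∀ k l → normE (k ++ l) ≡ normE (l ++ k)
  normE-comm k l = normE-resp-↭ (++-comm k l)

  positiveLength : List ℕ → ℕ
  positiveLength κ = length (filterᵇ positive κ)

  length-normE : ∀ k → length (normE k) ≡ positiveLength k
  length-normE k = ↭-length (normE-↭ k)

  normE-positive : ∀ ν → All (1 ≤_) (normE ν)
  normE-positive ν = All-resp-↭ (↭-sym (normE-↭ ν)) (All.map (≤ᵇ⇒≤ 1 _) (all-filter (T? ∘ positive) ν))

  normE-++-normE : ∀ k l → normE (k ++ l) ≡ normE (normE k ++ normE l)
  normE-++-normE k l = trans (normE-++ k l) (cong sortD (sym (filter-all (T? ∘ positive)
    (All.map ≤⇒≤ᵇ (All-++⁺ (normE-positive k) (normE-positive l))))))

  record Normaliser : Set where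
    field
      nrm      : List ℕ → List ℕ
      nrm-idem : ∀ k → nrm (nrm k) ≡ nrm k
      nrm-++   : ∀ k l → nrm (k ++ l) ≡ nrm (nrm k ++ nrm l)
      nrm-comm : ∀ k l → nrm (k ++ l) ≡ nrm (l ++ k)

  -- Keys of Λ: e_κ depends only on the multiset of nonzero parts of κ.
  normE-normaliser : Normaliser
  normE-normaliser = record { nrm = normE ; nrm-idem = normE-idem ; nrm-++ = normE-++-normE ; nrm-comm = normE-comm }

  -- Keys of polynomials: the monomial x_k depends only on the multiset k.
  sortD-normaliser : Normaliser
  sortD-normaliser = record
    { nrm = sortD ; nrm-idem = sortD-idem ; nrm-++ = sortD-++ ; nrm-comm = λ k l → sortD-resp-↭ (++-comm k l) }

module MatrixCount where

  open import Data.Nat using (ℕ; zero; suc; _+_; _∸_; _≤_; _⊓_)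
  open import Data.Nat.Properties
  open import Data.Nat.ListAction using (sum)
  open import Data.List using (List; []; _∷_; _++_; map; concatMap; filterᵇ; zipWith)
  open import Data.List.Relation.Unary.All as All using (All; []; _∷_)
  open import Data.List.Relation.Unary.All.Properties using (concat⁺; map⁺)
  open import Data.List.Relation.Binary.Pointwise as Pointwise using (Pointwise; []; _∷_)
  open import Data.List.Relation.Binary.Permutation.Propositional as Perm using (_↭_; ↭-sym)
  open import Data.List.Membership.Propositional using (_∈_; lose)
  open import Data.List.Membership.Propositional.Properties using (∈-concatMap⁺)
  open import Data.List.Relation.Unary.Any using (here)
  open import Data.Bool using (if_then_else_)
  open import Data.Product using (_×_; _,_)
  open import Relation.Binary.PropositionalEquality
  open Compositions
  open Sorting using (positive; normE-↭)
  open FiniteSum +-*-commutativeSemiring using (∑; ∑-cong; ∑-swap; ∑-comps; ∑-range-swap; ∑-concatMap)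

  _∸ᵛ_ : List ℕ → List ℕ → List ℕ
  _∸ᵛ_ = zipWith _∸_

  infixl 6 _∸ᵛ_

  isAllZero : List ℕ → ℕ
  isAllZero κ = if allZero κ then 1 else 0

  matCount-[] : ∀ κ → matCount κ [] ≡ isAllZero κ
  matCount-[] []          = refl
  matCount-[] (zero ∷ κ)  = trans (+-identityʳ _) (matCount-[] κ)
  matCount-[] (suc r ∷ κ) = refl

  -- Expansion along the first column, mirroring the definition's expansion along the first row.
  matCount-column : ∀ κ b ν → matCount κ (b ∷ ν) ≡ ∑ (comps b κ) (λ s → matCount (κ ∸ᵛ s) ν)
  matCount-column []      zero    ν = sym (+-identityʳ _)
  matCount-column []      (suc b) ν = refl
  matCount-column (a ∷ κ) b       ν = begin
    matCount (a ∷ κ) (b ∷ ν)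
      ≡⟨ ∑-comps a b ν _ ⟩
    ∑ (range b a) (λ i → ∑ (comps (a ∸ i) ν) (λ c → matCount κ ((b ∸ i) ∷ ν ∸ᵛ c)))
      ≡⟨ ∑-cong (range b a) (λ i → ∑-cong (comps (a ∸ i) ν) (λ c → matCount-column κ (b ∸ i) (ν ∸ᵛ c))) ⟩
    ∑ (range b a) (λ i → ∑ (comps (a ∸ i) ν) (λ c → ∑ (comps (b ∸ i) κ) (λ s → matCount (κ ∸ᵛ s) (ν ∸ᵛ c))))
      ≡⟨ ∑-cong (range b a) (λ i → ∑-swap (comps (a ∸ i) ν) (comps (b ∸ i) κ) _) ⟩
    ∑ (range b a) (λ i → ∑ (comps (b ∸ i) κ) (λ s → matCount ((a ∸ i) ∷ κ ∸ᵛ s) ν))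
      ≡⟨ cong (λ l → ∑ l (λ i → ∑ (comps (b ∸ i) κ) (λ s → matCount ((a ∸ i) ∷ κ ∸ᵛ s) ν))) (range-sym b a) ⟩
    ∑ (range a b) (λ i → ∑ (comps (b ∸ i) κ) (λ s → matCount ((a ∸ i) ∷ κ ∸ᵛ s) ν))
      ≡⟨ ∑-comps b a κ _ ⟨
    ∑ (comps b (a ∷ κ)) (λ s → matCount ((a ∷ κ) ∸ᵛ s) ν) ∎
    where open ≡-Reasoning

  matCount-zero-row : ∀ κ ρ → matCount (0 ∷ κ) ρ ≡ matCount κ ρ
  matCount-zero-row κ ρ rewrite comps-0 ρ | zipWith-∸-zeros ρ = +-identityʳ _

  matCount-swap-rows : ∀ a b κ ρ → matCount (a ∷ b ∷ κ) ρ ≡ matCount (b ∷ a ∷ κ) ρ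
  matCount-swap-rows a b κ [] = trans (matCount-[] (a ∷ b ∷ κ)) (trans (isAllZero-swap a b) (sym (matCount-[] (b ∷ a ∷ κ))))
    where
    isAllZero-swap : ∀ a b → isAllZero (a ∷ b ∷ κ) ≡ isAllZero (b ∷ a ∷ κ)
    isAllZero-swap zero    zero    = refl
    isAllZero-swap zero    (suc b) = refl
    isAllZero-swap (suc a) zero    = refl
    isAllZero-swap (suc a) (suc b) = refl
  matCount-swap-rows a b κ (r ∷ ρ) = begin
    matCount (a ∷ b ∷ κ) (r ∷ ρ)
      ≡⟨ matCount-column (a ∷ b ∷ κ) r ρ ⟩
    ∑ (comps r (a ∷ b ∷ κ)) (λ s → matCount ((a ∷ b ∷ κ) ∸ᵛ s) ρ)
      ≡⟨ ∑-comps r a (b ∷ κ) _ ⟩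
    ∑ (range a r) (λ x → ∑ (comps (r ∸ x) (b ∷ κ)) (λ s → matCount ((a ∸ x) ∷ (b ∷ κ) ∸ᵛ s) ρ))
      ≡⟨ ∑-cong (range a r) (λ x → ∑-comps (r ∸ x) b κ _) ⟩
    ∑ (range a r) (λ x → ∑ (range b (r ∸ x)) (λ y → ab x y (r ∸ x ∸ y)))
      ≡⟨ ∑-cong (range a r) (λ x → ∑-cong (range b (r ∸ x)) (λ y →
           ∑-cong (comps (r ∸ x ∸ y) κ) (λ s → matCount-swap-rows (a ∸ x) (b ∸ y) (κ ∸ᵛ s) ρ))) ⟩
    ∑ (range a r) (λ x → ∑ (range b (r ∸ x)) (λ y → ba x y (r ∸ x ∸ y)))
      ≡⟨ ∑-range-swap a b r (λ x y → ba x y (r ∸ x ∸ y)) ⟩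
    ∑ (range b r) (λ y → ∑ (range a (r ∸ y)) (λ x → ba x y (r ∸ x ∸ y)))
      ≡⟨ ∑-cong (range b r) (λ y → ∑-cong (range a (r ∸ y)) (λ x → cong (ba x y) (∸-exchange r x y))) ⟩
    ∑ (range b r) (λ y → ∑ (range a (r ∸ y)) (λ x → ba x y (r ∸ y ∸ x)))
      ≡⟨ ∑-cong (range b r) (λ y → ∑-comps (r ∸ y) a κ _) ⟨
    ∑ (range b r) (λ y → ∑ (comps (r ∸ y) (a ∷ κ)) (λ s → matCount ((b ∸ y) ∷ (a ∷ κ) ∸ᵛ s) ρ))
      ≡⟨ ∑-comps r b (a ∷ κ) _ ⟨
    ∑ (comps r (b ∷ a ∷ κ)) (λ s → matCount ((b ∷ a ∷ κ) ∸ᵛ s) ρ)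
      ≡⟨ matCount-column (b ∷ a ∷ κ) r ρ ⟨
    matCount (b ∷ a ∷ κ) (r ∷ ρ) ∎
    where
    open ≡-Reasoning
    ab ba : ℕ → ℕ → ℕ → ℕ
    ab x y q = ∑ (comps q κ) (λ s → matCount ((a ∸ x) ∷ (b ∸ y) ∷ κ ∸ᵛ s) ρ)
    ba x y q = ∑ (comps q κ) (λ s → matCount ((b ∸ y) ∷ (a ∸ x) ∷ κ ∸ᵛ s) ρ)
    ∸-exchange : ∀ r x y → r ∸ x ∸ y ≡ r ∸ y ∸ x
    ∸-exchange r x y = trans (∸-+-assoc r x y) (trans (cong (r ∸_) (+-comm x y)) (sym (∸-+-assoc r y x)))

  matCount-resp-↭ : ∀ {κ κ′} → κ ↭ κ′ → ∀ ρ → matCount κ ρ ≡ matCount κ′ ρ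
  matCount-resp-↭ Perm.refl                   ρ = refl
  matCount-resp-↭ (Perm.prep x p)             ρ = ∑-cong (comps x ρ) (λ c → matCount-resp-↭ p _)
  matCount-resp-↭ (Perm.swap {κ} {κ′} x y p)  ρ = trans (matCount-swap-rows x y κ ρ)
    (∑-cong (comps y ρ) (λ c → ∑-cong (comps x _) (λ c′ → matCount-resp-↭ p _)))
  matCount-resp-↭ (Perm.trans p q)            ρ = trans (matCount-resp-↭ p ρ) (matCount-resp-↭ q ρ)

  matCount-filter-positive : ∀ κ ρ → matCount κ ρ ≡ matCount (filterᵇ positive κ) ρ
  matCount-filter-positive []          ρ = refl
  matCount-filter-positive (zero ∷ κ)  ρ = trans (matCount-zero-row κ ρ) (matCount-filter-positive κ ρ)
  matCount-filter-positive (suc x ∷ κ) ρ = ∑-cong (comps (suc x) ρ) (λ c → matCount-filter-positive κ _)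

  matCount-normE : ∀ κ ρ → matCount κ ρ ≡ matCount (normE κ) ρ
  matCount-normE κ ρ = trans (matCount-filter-positive κ ρ) (matCount-resp-↭ (↭-sym (normE-↭ κ)) ρ)

  sum-∸ᵛ : ∀ {s κ} → Pointwise _≤_ s κ → sum (κ ∸ᵛ s) + sum s ≡ sum κ
  sum-∸ᵛ []                       = refl
  sum-∸ᵛ {x ∷ s} {k ∷ κ} (x≤k ∷ p) = begin
    (k ∸ x + sum (κ ∸ᵛ s)) + (x + sum s) ≡⟨ +-assoc (k ∸ x) _ _ ⟩
    k ∸ x + (sum (κ ∸ᵛ s) + (x + sum s)) ≡⟨ cong (k ∸ x +_) (+-comm-middle (sum (κ ∸ᵛ s)) x (sum s)) ⟩
    k ∸ x + (x + (sum (κ ∸ᵛ s) + sum s)) ≡⟨ +-assoc (k ∸ x) x _ ⟨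
    (k ∸ x + x) + (sum (κ ∸ᵛ s) + sum s) ≡⟨ cong₂ _+_ (m∸n+n≡m x≤k) (sum-∸ᵛ p) ⟩
    k + sum κ                            ∎
    where
    open ≡-Reasoning
    +-comm-middle : ∀ a b c → a + (b + c) ≡ b + (a + c)
    +-comm-middle a b c = trans (sym (+-assoc a b c)) (trans (cong (_+ c) (+-comm a b)) (+-assoc b a c))

  -- The row-sum vectors that remain after filling columns μ of a matrix with row sums κ.
  residues : List ℕ → List ℕ → List (List ℕ)
  residues []      κ = κ ∷ []
  residues (b ∷ μ) κ = concatMap (λ s → residues μ (κ ∸ᵛ s)) (comps b κ)

  matCount-++ : ∀ μ κ ρ → matCount κ (μ ++ ρ) ≡ ∑ (residues μ κ) (λ κ′ → matCount κ′ ρ)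
  matCount-++ []      κ ρ = sym (+-identityʳ _)
  matCount-++ (b ∷ μ) κ ρ = trans (matCount-column κ b (μ ++ ρ))
    (trans (∑-cong (comps b κ) (λ s → matCount-++ μ (κ ∸ᵛ s) ρ))
           (sym (∑-concatMap (comps b κ) (λ s → residues μ (κ ∸ᵛ s)) _)))

  IsResidue : List ℕ → List ℕ → List ℕ → Set
  IsResidue μ κ κ′ = Pointwise _≤_ κ′ κ × sum κ′ + sum μ ≡ sum κ

  ∸ᵛ-≤ : ∀ {s κ} → Pointwise _≤_ s κ → Pointwise _≤_ (κ ∸ᵛ s) κ
  ∸ᵛ-≤ []                    = []
  ∸ᵛ-≤ {x ∷ s} {k ∷ κ} (_ ∷ p) = m∸n≤m k x ∷ ∸ᵛ-≤ p

  residues-sound : ∀ μ κ → All (IsResidue μ κ) (residues μ κ)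
  residues-sound []      κ = (Pointwise.refl ≤-refl , +-identityʳ _) ∷ []
  residues-sound (b ∷ μ) κ = concat⁺ (map⁺ (All.map (λ {s} → step s) (comps-sound b κ)))
    where
    step : ∀ s → IsComposition b κ s → All (IsResidue (b ∷ μ) κ) (residues μ (κ ∸ᵛ s))
    step s (s≤κ , Σs) = All.map (λ {κ′} (κ′≤ , Σκ′) → Pointwise.transitive ≤-trans κ′≤ (∸ᵛ-≤ s≤κ) , (begin
      sum κ′ + (b + sum μ)          ≡⟨ cong (sum κ′ +_) (+-comm b (sum μ)) ⟩
      sum κ′ + (sum μ + b)          ≡⟨ +-assoc (sum κ′) (sum μ) b ⟨
      (sum κ′ + sum μ) + b          ≡⟨ cong₂ _+_ Σκ′ (sym Σs) ⟩
      sum (κ ∸ᵛ s) + sum s          ≡⟨ sum-∸ᵛ s≤κ ⟩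
      sum κ                         ∎)) (residues-sound μ (κ ∸ᵛ s))
      where open ≡-Reasoning

  greedy : ℕ → List ℕ → List ℕ
  greedy b []       = []
  greedy b (d ∷ ds) = d ⊓ b ∷ greedy (b ∸ d) ds

  greedy-≤ : ∀ b d → Pointwise _≤_ (greedy b d) d
  greedy-≤ b []       = []
  greedy-≤ b (d ∷ ds) = m⊓n≤m d b ∷ greedy-≤ (b ∸ d) ds

  sum-greedy : ∀ b d → b ≤ sum d → sum (greedy b d) ≡ b
  sum-greedy b []       b≤0 = sym (n≤0⇒n≡0 b≤0)
  sum-greedy b (d ∷ ds) b≤Σ = trans (cong (d ⊓ b +_) (sum-greedy (b ∸ d) ds b∸d≤Σds)) (m⊓n+n∸m≡n d b)
    where b∸d≤Σds = subst (b ∸ d ≤_) (m+n∸m≡n d (sum ds)) (∸-monoˡ-≤ d b≤Σ)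

  sum-mono : ∀ {a b} → Pointwise _≤_ a b → sum a ≤ sum b
  sum-mono []      = ≤-refl
  sum-mono (x ∷ p) = +-mono-≤ x (sum-mono p)

  ≤-sum-≥⇒≡ : ∀ {t κ} → Pointwise _≤_ t κ → sum κ ≤ sum t → t ≡ κ
  ≤-sum-≥⇒≡ []                       _   = refl
  ≤-sum-≥⇒≡ {x ∷ t} {k ∷ κ} (x≤k ∷ p) Σ≤Σ = cong₂ _∷_ x≡k (≤-sum-≥⇒≡ p Σκ≤Σt)
    where
    Σκ≤Σt : sum κ ≤ sum t
    Σκ≤Σt = +-cancelˡ-≤ k (sum κ) (sum t) (≤-trans Σ≤Σ (+-monoˡ-≤ (sum t) x≤k))
    x≡k : x ≡ k
    x≡k = ≤-antisym x≤k (+-cancelʳ-≤ (sum t) k x (≤-trans (+-monoʳ-≤ k (sum-mono p)) Σ≤Σ))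

  ≤-∸ᵛ : ∀ {t κ s} → Pointwise _≤_ t κ → Pointwise _≤_ s (κ ∸ᵛ t) → Pointwise _≤_ t (κ ∸ᵛ s)
  ≤-∸ᵛ []                            []          = []
  ≤-∸ᵛ {x ∷ t} {k ∷ κ} {y ∷ s} (x≤k ∷ p) (y≤ ∷ q) = x≤k∸y ∷ ≤-∸ᵛ p q
    where
    x≤k∸y : x ≤ k ∸ y
    x≤k∸y = subst (_≤ k ∸ y) (m+n∸m≡n y x) (∸-monoˡ-≤ y (subst (y + x ≤_) (m∸n+n≡m x≤k) (+-monoˡ-≤ x y≤)))

  -- Every vector t below κ with the right sum is reached, filling each column greedily from the top.
  residues-complete : ∀ μ κ t → Pointwise _≤_ t κ → sum κ ≡ sum t + sum μ → t ∈ residues μ κ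
  residues-complete []      κ t t≤κ Σκ = here (≤-sum-≥⇒≡ t≤κ (≤-reflexive (trans Σκ (+-identityʳ (sum t)))))
  residues-complete (b ∷ μ) κ t t≤κ Σκ =
    ∈-concatMap⁺ (λ s → residues μ (κ ∸ᵛ s)) (lose s∈comps
      (residues-complete μ (κ ∸ᵛ s) t (≤-∸ᵛ t≤κ (greedy-≤ b d)) Σκ∸s))
    where
    d = κ ∸ᵛ t
    s = greedy b d
    Σd : sum d ≡ b + sum μ
    Σd = +-cancelʳ-≡ (sum t) (sum d) (b + sum μ) (trans (sum-∸ᵛ t≤κ) (trans Σκ (+-comm (sum t) _)))
    Σs : sum s ≡ b
    Σs = sum-greedy b d (subst (b ≤_) (sym Σd) (m≤m+n b (sum μ)))
    s≤κ : Pointwise _≤_ s κ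
    s≤κ = Pointwise.transitive ≤-trans (greedy-≤ b d) (∸ᵛ-≤ t≤κ)
    s∈comps : s ∈ comps b κ
    s∈comps = subst (λ r → s ∈ comps r κ) Σs (comps-complete s≤κ)
    Σκ∸s : sum (κ ∸ᵛ s) ≡ sum t + sum μ
    Σκ∸s = +-cancelʳ-≡ b _ _ (begin
      sum (κ ∸ᵛ s) + b          ≡⟨ cong (sum (κ ∸ᵛ s) +_) Σs ⟨
      sum (κ ∸ᵛ s) + sum s      ≡⟨ sum-∸ᵛ s≤κ ⟩
      sum κ                     ≡⟨ Σκ ⟩
      sum t + (b + sum μ)       ≡⟨ cong (sum t +_) (+-comm b (sum μ)) ⟩
      sum t + (sum μ + b)       ≡⟨ +-assoc (sum t) (sum μ) b ⟨
      sum t + sum μ + b         ∎)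
      where open ≡-Reasoning

module Subtractions where

  open import Data.Nat using (ℕ; zero; suc; _+_; _∸_; _≤ᵇ_; _≤_; _<_; _⊓_; z≤n; s≤s)
  open import Data.Nat.Properties
  open import Data.Nat.ListAction using (sum)
  open import Data.List using (List; []; _∷_; _++_; map; upTo; filterᵇ; length)
  open import Data.List.Relation.Unary.All as All using (All; []; _∷_)
  open import Data.List.Relation.Unary.All.Properties using (++⁺; map⁺)
  open import Data.Bool using (true; false; if_then_else_)
  open import Data.Empty using (⊥-elim)
  open import Data.Sum using (_⊎_; inj₁; inj₂)
  open import Data.Product using (_×_; _,_; Σ)
  open import Relation.Binary.PropositionalEquality
  open import Relation.Nullary using (¬_)
  open BoolComparison
  open Sorting using (positive; positiveLength; insertD-comm)
  open MatrixCount using (isAllZero)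
  open FiniteSum +-*-commutativeSemiring using (∑; ∑-cong; ∑-zero; ∑-zero-All; ∑-+; ∑-map; ∑-upTo-∷ʳ)

  subtractFromPart : ℕ → List ℕ → List (List ℕ)
  subtractFromPart n []      = []
  subtractFromPart n (k ∷ κ) =
    (if n ≤ᵇ k then ((k ∸ n) ∷ κ) ∷ [] else []) ++ map (k ∷_) (subtractFromPart n κ)

  subtractionCount : List ℕ → List ℕ → ℕ
  subtractionCount κ []      = isAllZero κ
  subtractionCount κ (n ∷ ν) = ∑ (subtractFromPart n κ) (λ κ′ → subtractionCount κ′ ν)

  countAtLeast : ℕ → List ℕ → ℕ
  countAtLeast i []      = 0
  countAtLeast i (x ∷ s) = (if i ≤ᵇ x then 1 else 0) + countAtLeast i s

  ∑-countAtLeast : ∀ n s → All (_≤ n) s → ∑ (upTo n) (λ j → countAtLeast (suc j) s) ≡ sum s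
  ∑-countAtLeast n []      []          = ∑-zero (upTo n) (λ _ → refl)
  ∑-countAtLeast n (x ∷ s) (x≤n ∷ s≤n) = trans (∑-+ (upTo n) (λ j → if suc j ≤ᵇ x then 1 else 0) _)
    (cong₂ _+_ (trans (count-single n) (m≥n⇒m⊓n≡n x≤n)) (∑-countAtLeast n s s≤n))
    where
    count-single : ∀ n → ∑ (upTo n) (λ j → if suc j ≤ᵇ x then 1 else 0) ≡ n ⊓ x
    count-single zero    = refl
    count-single (suc n) = trans (∑-upTo-∷ʳ n (λ j → if suc j ≤ᵇ x then 1 else 0))
                                 (trans (cong (_+ (if suc n ≤ᵇ x then 1 else 0)) (count-single n)) last-step)
      where
      last-step : n ⊓ x + (if suc n ≤ᵇ x then 1 else 0) ≡ suc n ⊓ x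
      last-step with suc n ≤ᵇ x in e
      ... | true  rewrite m≤n⇒m⊓n≡m (<⇒≤ (≤ᵇ-true⇒≤ (suc n) x e))
                        | m≤n⇒m⊓n≡m (≤ᵇ-true⇒≤ (suc n) x e) = +-comm n 1
      ... | false rewrite m≥n⇒m⊓n≡n (≮⇒≥ (≤ᵇ-false⇒≰ (suc n) x e))
                        | m≥n⇒m⊓n≡n (m≤n⇒m≤1+n (≮⇒≥ (≤ᵇ-false⇒≰ (suc n) x e))) = +-identityʳ x

  countAtLeast-sum< : ∀ i s → sum s < i → countAtLeast i s ≡ 0
  countAtLeast-sum< i []      _   = refl
  countAtLeast-sum< i (x ∷ s) Σ<i with i ≤ᵇ x in e
  ... | true  = ⊥-elim (<⇒≱ Σ<i (≤-trans (≤ᵇ-true⇒≤ i x e) (m≤m+n x (sum s))))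
  ... | false = countAtLeast-sum< i s (≤-<-trans (m≤n+m (sum s) x) Σ<i)

  All-≤-sum : ∀ s → All (_≤ sum s) s
  All-≤-sum []      = []
  All-≤-sum (x ∷ s) = m≤m+n x (sum s) ∷ All.map (λ y≤Σs → ≤-trans y≤Σs (m≤n+m (sum s) x)) (All-≤-sum s)

  SubtractionStep : ℕ → List ℕ → List ℕ → Set
  SubtractionStep n κ κ′ = positiveLength κ′ ≡ positiveLength κ
                         ⊎ suc (positiveLength κ′) ≡ positiveLength κ × normE κ ≡ insertD n (normE κ′)

  subtractFromPart-sound : ∀ n κ → 1 ≤ n → All (SubtractionStep n κ) (subtractFromPart n κ)
  subtractFromPart-sound n []      _   = []
  subtractFromPart-sound n (k ∷ κ) 1≤n =
    ++⁺ head-removal (map⁺ (All.map (λ {κ′} → cons-removal k κ′) (subtractFromPart-sound n κ 1≤n)))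
    where
    head-removal : All (SubtractionStep n (k ∷ κ)) (if n ≤ᵇ k then ((k ∸ n) ∷ κ) ∷ [] else [])
    head-removal with n ≤ᵇ k in e
    ... | false = []
    ... | true  = removal k e ∷ []
      where
      removal : ∀ k → (n ≤ᵇ k) ≡ true → SubtractionStep n (k ∷ κ) ((k ∸ n) ∷ κ)
      removal zero    e = ⊥-elim (<⇒≱ 1≤n (≤ᵇ-true⇒≤ n 0 e))
      removal (suc k) e with suc k ∸ n in e′
      ... | suc _ = inj₁ refl
      ... | zero  = inj₂ (refl , cong (λ z → insertD z (normE κ))
                                      (≤-antisym (m∸n≡0⇒m≤n {suc k} {n} e′) (≤ᵇ-true⇒≤ n (suc k) e)))
    cons-removal : ∀ k κ′ → SubtractionStep n κ κ′ → SubtractionStep n (k ∷ κ) (k ∷ κ′)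
    cons-removal zero    κ′ (inj₁ e)        = inj₁ e
    cons-removal (suc k) κ′ (inj₁ e)        = inj₁ (cong suc e)
    cons-removal zero    κ′ (inj₂ (e , e′)) = inj₂ (e , e′)
    cons-removal (suc k) κ′ (inj₂ (e , e′)) =
      inj₂ (cong suc e , trans (cong (insertD (suc k)) e′) (insertD-comm (suc k) n (normE κ′)))

  subtractionCount-vanishes : ∀ ν → All (1 ≤_) ν → ∀ κ → length ν < positiveLength κ →
                              subtractionCount κ ν ≡ 0
  subtractionCount-vanishes [] [] κ ℓ<ℓ⁺ with allZero κ in e
  ... | true  = ⊥-elim (<⇒≱ ℓ<ℓ⁺ (≤-reflexive (allZero⇒positiveLength≡0 κ e)))
    where
    allZero⇒positiveLength≡0 : ∀ κ → allZero κ ≡ true → positiveLength κ ≡ 0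
    allZero⇒positiveLength≡0 []         _ = refl
    allZero⇒positiveLength≡0 (zero ∷ κ) e = allZero⇒positiveLength≡0 κ e
  ... | false = refl
  subtractionCount-vanishes (n ∷ ν) (1≤n ∷ 1≤ν) κ ℓ<ℓ⁺ =
    ∑-zero-All (All.map (λ {κ′} → vanishes κ′) (subtractFromPart-sound n κ 1≤n))
    where
    vanishes : ∀ κ′ → SubtractionStep n κ κ′ → subtractionCount κ′ ν ≡ 0
    vanishes κ′ (inj₁ e)       =
      subtractionCount-vanishes ν 1≤ν κ′ (subst (length ν <_) (sym e) (<-trans (n<1+n _) ℓ<ℓ⁺))
    vanishes κ′ (inj₂ (e , _)) =
      subtractionCount-vanishes ν 1≤ν κ′ (≤-pred (subst (suc (length ν) <_) (sym e) ℓ<ℓ⁺))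

  ∑-nonzero : ∀ {A : Set} {P : A → Set} (xs : List A) (f : A → ℕ) → All P xs → ¬ (∑ xs f ≡ 0) →
              Σ A (λ x → P x × ¬ (f x ≡ 0))
  ∑-nonzero []       f []       ∑≢0 = ⊥-elim (∑≢0 refl)
  ∑-nonzero (x ∷ xs) f (p ∷ ps) ∑≢0 with f x in e
  ... | suc _ = x , p , λ e′ → 0≢1+n (trans (sym e′) e)
  ... | zero  = ∑-nonzero xs f ps ∑≢0

  subtractionCount≢0⇒normE≡ : ∀ ν → All (1 ≤_) ν → ∀ κ → positiveLength κ ≡ length ν →
                              ¬ (subtractionCount κ ν ≡ 0) → normE κ ≡ normE ν
  subtractionCount≢0⇒normE≡ [] [] κ e _ with filterᵇ positive κ
  ... | [] = refl
  subtractionCount≢0⇒normE≡ (suc m ∷ ν) (1≤n ∷ 1≤ν) κ e ≢0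
    with ∑-nonzero (subtractFromPart (suc m) κ) (λ κ′ → subtractionCount κ′ ν)
                   (subtractFromPart-sound (suc m) κ 1≤n) ≢0
  ... | κ′ , inj₁ e′ , ≢0′ =
    ⊥-elim (≢0′ (subtractionCount-vanishes ν 1≤ν κ′ (subst (length ν <_) (sym (trans e′ e)) (n<1+n _))))
  ... | κ′ , inj₂ (e′ , e″) , ≢0′ =
    trans e″ (cong (insertD (suc m)) (subtractionCount≢0⇒normE≡ ν 1≤ν κ′ (suc-injective (trans e′ e)) ≢0′))

  subtractionCount-zero-row : ∀ ν → All (1 ≤_) ν → ∀ κ → subtractionCount (0 ∷ κ) ν ≡ subtractionCount κ ν
  subtractionCount-zero-row []          []        κ = refl
  subtractionCount-zero-row (suc m ∷ ν) (_ ∷ 1≤ν) κ =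
    trans (∑-map (subtractFromPart (suc m) κ) (0 ∷_) _)
          (∑-cong (subtractFromPart (suc m) κ) (subtractionCount-zero-row ν 1≤ν))

  subtractionCount-self : ∀ ν → All (1 ≤_) ν → 1 ≤ subtractionCount ν ν
  subtractionCount-self []          []        = s≤s z≤n
  subtractionCount-self (suc m ∷ ν) (_ ∷ 1≤ν) rewrite ≤⇒≤ᵇ-true (≤-refl {suc m}) | n∸n≡0 m =
    ≤-trans (subst (1 ≤_) (sym (subtractionCount-zero-row ν 1≤ν ν)) (subtractionCount-self ν 1≤ν)) (m≤m+n _ _)

module Coefficients {c ℓ} (F : Field c ℓ) where

  open import Data.Nat as ℕ using (ℕ; zero; suc; _≤_; s≤s)
  import Data.Nat.Properties as ℕP
  open import Data.List using (List; []; _∷_; _++_; map; filterᵇ; length)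
  open import Data.List.Properties using (≡-dec; length-filter)
  open import Data.List.Relation.Unary.All as All using (All; []; _∷_)
  open import Data.List.Relation.Unary.All.Properties using (all-filter)
  open import Data.Bool using (Bool; true; false; not; T)
  open import Data.Product using (_×_; _,_; proj₁; proj₂)
  open import Data.Empty using (⊥-elim)
  open import Function using (_∘_)
  open import Relation.Binary.PropositionalEquality as P using (_≡_)
  open import Relation.Nullary using (¬_; does; yes; no)
  open import Relation.Nullary.Decidable using (T?)
  open BoolComparison using (T⇒≡true; T-not⇒≡false)
  open Field F public
  open FiniteSum commutativeSemiring public
  open import Relation.Binary.Reasoning.Setoid setoid
  open import Algebra.Properties.Ring ring public using (-1*x≈-x; -‿distribˡ-*)
  open import Algebra.Properties.Group +-group public using (x∙y⁻¹≈ε⇒x≈y; x≈y⇒x∙y⁻¹≈ε)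
  open import Algebra.Properties.CommutativeSemigroup *-commutativeSemigroup public using (x∙yz≈y∙xz)

  Key : Set
  Key = List ℕ

  FS : Set c
  FS = FSum F

  infixl 7 _*L_ _•L_

  _*L_ : FS → FS → FS
  _*L_ = _*Λ_ F

  _•L_ : Carrier → FS → FS
  _•L_ = _•Λ_ F

  1L : FS
  1L = 1Λ F

  eL : Key → FS
  eL = eΛ F

  e[_] : ℕ → FS
  e[ n ] = eL (n ∷ [])

  prodL : List FS → FS
  prodL = prodΛ F

  evL : (ℕ → FS) → FS → FS
  evL = eval F

  ⟦_⟧ : ℕ → Carrier
  ⟦_⟧ = fromℕ F

  fromℕ-+ : ∀ m n → ⟦ m ℕ.+ n ⟧ ≈ ⟦ m ⟧ + ⟦ n ⟧
  fromℕ-+ zero    n = sym (+-identityˡ _)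
  fromℕ-+ (suc m) n = trans (+-cong refl (fromℕ-+ m n)) (sym (+-assoc _ _ _))

  char0⇒⟦n⟧≉0 : CharZero F → ∀ n → 1 ≤ n → ¬ (⟦ n ⟧ ≈ 0#)
  char0⇒⟦n⟧≉0 char0 (suc m) _ = char0 m

  x*y≈0⇒x≈0 : ∀ {x y} → x * y ≈ 0# → ¬ (y ≈ 0#) → x ≈ 0#
  x*y≈0⇒x≈0 {x} {y} xy≈0 y≉0 with inverse y y≉0
  ... | y⁻¹ , yy⁻¹≈1 = begin
    x              ≈⟨ *-identityʳ x ⟨
    x * 1#         ≈⟨ *-cong refl yy⁻¹≈1 ⟨
    x * (y * y⁻¹)  ≈⟨ *-assoc _ _ _ ⟨
    (x * y) * y⁻¹  ≈⟨ *-cong xy≈0 refl ⟩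
    0# * y⁻¹       ≈⟨ zeroˡ y⁻¹ ⟩
    0#             ∎

  module ℕ∑ = FiniteSum ℕP.+-*-commutativeSemiring

  fromℕ-∑ : ∀ {b} {A : Set b} (xs : List A) (f : A → ℕ) → ⟦ ℕ∑.∑ xs f ⟧ ≈ ∑ xs (⟦_⟧ ∘ f)
  fromℕ-∑ []       f = refl
  fromℕ-∑ (x ∷ xs) f = trans (fromℕ-+ (f x) _) (+-cong refl (fromℕ-∑ xs f))

  fromℕ-when : ∀ b n → ⟦ ℕ∑.when b n ⟧ ≈ when b ⟦ n ⟧
  fromℕ-when true  n = refl
  fromℕ-when false n = refl

  δ : (Key → Key) → Key → Key → Bool
  δ nrm ν k = does (≡-dec ℕP._≟_ (nrm k) ν)

  δ-≡ : ∀ nrm ν k → nrm k ≡ ν → δ nrm ν k ≡ true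
  δ-≡ nrm ν k e with ≡-dec ℕP._≟_ (nrm k) ν
  ... | yes _ = P.refl
  ... | no ≢  = ⊥-elim (≢ e)

  δ-≢ : ∀ nrm ν k → ¬ (nrm k ≡ ν) → δ nrm ν k ≡ false
  δ-≢ nrm ν k ≢ with ≡-dec ℕP._≟_ (nrm k) ν
  ... | yes e = ⊥-elim (≢ e)
  ... | no _  = P.refl

  δ-true⇒≡ : ∀ nrm ν k → δ nrm ν k ≡ true → nrm k ≡ ν
  δ-true⇒≡ nrm ν k e with ≡-dec ℕP._≟_ (nrm k) ν
  ... | yes p = p

  coeff : (Key → Key) → FS → Key → Carrier
  coeff nrm g ν = ∑ g (λ p → when (δ nrm ν (proj₂ p)) (proj₁ p))

  coeffWith≈coeff : ∀ nrm g ν → coeffWith F nrm g ν ≈ coeff nrm g ν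
  coeffWith≈coeff nrm []            ν = refl
  coeffWith≈coeff nrm ((a , k) ∷ g) ν with δ nrm ν k
  ... | true  = +-cong refl (coeffWith≈coeff nrm g ν)
  ... | false = trans (coeffWith≈coeff nrm g ν) (sym (+-identityˡ _))

  ∫ : FS → (Key → Carrier) → Carrier
  ∫ g φ = ∑ g (λ p → proj₁ p * φ (proj₂ p))

  ∫-cong : ∀ g {φ ψ : Key → Carrier} → (∀ k → φ k ≈ ψ k) → ∫ g φ ≈ ∫ g ψ
  ∫-cong g φ≈ψ = ∑-cong g (λ p → *-cong refl (φ≈ψ (proj₂ p)))

  ∫-+ : ∀ g (φ ψ : Key → Carrier) → ∫ g (λ k → φ k + ψ k) ≈ ∫ g φ + ∫ g ψ
  ∫-+ g φ ψ = trans (∑-cong g (λ p → distribˡ _ _ _)) (∑-+ g _ _)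

  ∫-*ˡ : ∀ g a (φ : Key → Carrier) → ∫ g (λ k → a * φ k) ≈ a * ∫ g φ
  ∫-*ˡ g a φ = trans (∑-cong g (λ p → x∙yz≈y∙xz _ _ _)) (∑-*ˡ g a _)

  ∫-*ʳ : ∀ g (φ : Key → Carrier) a → ∫ g (λ k → φ k * a) ≈ ∫ g φ * a
  ∫-*ʳ g φ a = trans (∑-cong g (λ p → sym (*-assoc _ _ _))) (∑-*ʳ g a _)

  ∫-swap : ∀ g h (f : Key → Key → Carrier) → ∫ g (λ k → ∫ h (f k)) ≈ ∫ h (λ l → ∫ g (λ k → f k l))
  ∫-swap g h f = begin
    ∑ g (λ p → proj₁ p * ∑ h (λ q → proj₁ q * f (proj₂ p) (proj₂ q)))   ≈⟨ ∑-cong g (λ p → ∑-*ˡ h (proj₁ p) _) ⟨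
    ∑ g (λ p → ∑ h (λ q → proj₁ p * (proj₁ q * f (proj₂ p) (proj₂ q)))) ≈⟨ ∑-swap g h _ ⟩
    ∑ h (λ q → ∑ g (λ p → proj₁ p * (proj₁ q * f (proj₂ p) (proj₂ q))))
                                                                        ≈⟨ ∑-cong h (λ q → ∑-cong g (λ p → x∙yz≈y∙xz _ _ _)) ⟩
    ∑ h (λ q → ∑ g (λ p → proj₁ q * (proj₁ p * f (proj₂ p) (proj₂ q)))) ≈⟨ ∑-cong h (λ q → ∑-*ˡ g (proj₁ q) _) ⟩
    ∑ h (λ q → proj₁ q * ∑ g (λ p → proj₁ p * f (proj₂ p) (proj₂ q)))   ∎

  ∫-++ : ∀ g h φ → ∫ (g ++ h) φ ≈ ∫ g φ + ∫ h φ
  ∫-++ g h φ = ∑-++ g h _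

  coeff-++ : ∀ nrm g h ν → coeff nrm (g ++ h) ν ≈ coeff nrm g ν + coeff nrm h ν
  coeff-++ nrm g h ν = ∑-++ g h _

  neg : FS → FS
  neg = map (λ p → (- proj₁ p , proj₂ p))

  ∑-neg : ∀ g (f : Carrier × Key → Carrier) → (∀ p → f (- proj₁ p , proj₂ p) ≈ - f p) → ∑ (neg g) f ≈ - ∑ g f
  ∑-neg g f f-neg = begin
    ∑ (neg g) f                   ≡⟨ ∑-map g _ f ⟩
    ∑ g (λ p → f (- proj₁ p , proj₂ p)) ≈⟨ ∑-cong g (λ p → trans (f-neg p) (sym (-1*x≈-x (f p)))) ⟩
    ∑ g (λ p → - 1# * f p)        ≈⟨ ∑-*ˡ g (- 1#) f ⟩
    - 1# * ∑ g f                  ≈⟨ -1*x≈-x _ ⟩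
    - ∑ g f                       ∎

  coeff-neg : ∀ nrm h ν → coeff nrm (neg h) ν ≈ - coeff nrm h ν
  coeff-neg nrm h ν = ∑-neg h _ (λ p → when-neg (δ nrm ν (proj₂ p)) (proj₁ p))
    where
    when-neg : ∀ b x → when b (- x) ≈ - when b x
    when-neg true  x = refl
    when-neg false x = sym (trans (sym (+-identityˡ (- 0#))) (-‿inverseʳ 0#))

  ∫-neg : ∀ h φ → ∫ (neg h) φ ≈ - ∫ h φ
  ∫-neg h φ = ∑-neg h _ (λ p → sym (-‿distribˡ-* (proj₁ p) (φ (proj₂ p))))

  module _ (nrm : Key → Key) where

    -- Induction on the length: the terms sharing the normal form of the first key cancel in
    -- the coefficient, and the remaining terms form a shorter sum with vanishing coefficients.
    coeff-zero⇒∫-zero : ∀ n g → length g ≤ n → (∀ ν → coeff nrm g ν ≈ 0#) → ∀ φ → ∫ g (φ ∘ nrm) ≈ 0#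
    coeff-zero⇒∫-zero n       []            _ _ φ = refl
    coeff-zero⇒∫-zero (suc n) ((a , k) ∷ g) (s≤s ∣g∣≤n) coeff≈0 φ = begin
      a * φ ν₀ + ∫ g (φ ∘ nrm)                         ≈⟨ +-cong refl (∑-partition same g _) ⟩
      a * φ ν₀ + (∫ g₌ (φ ∘ nrm) + ∫ g≠ (φ ∘ nrm))     ≈⟨ +-cong refl (+-cong ∫g₌ ∫g≠) ⟩
      a * φ ν₀ + (∑ g₌ proj₁ * φ ν₀ + 0#)              ≈⟨ +-cong refl (+-identityʳ _) ⟩
      a * φ ν₀ + ∑ g₌ proj₁ * φ ν₀                     ≈⟨ distribʳ _ _ _ ⟨
      (a + ∑ g₌ proj₁) * φ ν₀                          ≈⟨ *-cong leading-coeff refl ⟩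
      0# * φ ν₀                                         ≈⟨ zeroˡ _ ⟩
      0#                                                ∎
      where
      ν₀ = nrm k
      same : Carrier × Key → Bool
      same q = δ nrm ν₀ (proj₂ q)
      g₌ = filterᵇ same g
      g≠ = filterᵇ (not ∘ same) g
      g₌-same : All (T ∘ same) g₌
      g₌-same = all-filter (T? ∘ same) g
      g≠-other : All (T ∘ not ∘ same) g≠
      g≠-other = all-filter (T? ∘ not ∘ same) g
      ∫g₌ : ∫ g₌ (φ ∘ nrm) ≈ ∑ g₌ proj₁ * φ ν₀
      ∫g₌ = trans (∑-cong-All (All.map (λ {q} t → *-cong refl (reflexive (P.cong φ (δ-true⇒≡ nrm ν₀ (proj₂ q) (T⇒≡true t)))))
                                       g₌-same))
                  (∑-*ʳ g₌ (φ ν₀) proj₁)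
      coeff-g₌-ν₀ : coeff nrm g₌ ν₀ ≈ ∑ g₌ proj₁
      coeff-g₌-ν₀ = ∑-cong-All (All.map (λ {q} t → reflexive (P.cong (λ b → when b (proj₁ q)) (T⇒≡true t))) g₌-same)
      coeff-g≠-ν₀ : coeff nrm g≠ ν₀ ≈ 0#
      coeff-g≠-ν₀ = ∑-zero-All (All.map (λ {q} t → reflexive (P.cong (λ b → when b (proj₁ q)) (T-not⇒≡false t))) g≠-other)
      leading-coeff : a + ∑ g₌ proj₁ ≈ 0#
      leading-coeff = begin
        a + ∑ g₌ proj₁                                ≈⟨ +-cong (reflexive (P.cong (λ b → when b a) (δ-≡ nrm ν₀ k P.refl)))
                                                                 (trans (+-cong coeff-g₌-ν₀ coeff-g≠-ν₀) (+-identityʳ _)) ⟨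
        when (δ nrm ν₀ k) a + (coeff nrm g₌ ν₀ + coeff nrm g≠ ν₀) ≈⟨ +-cong refl (∑-partition same g _) ⟨
        coeff nrm ((a , k) ∷ g) ν₀                    ≈⟨ coeff≈0 ν₀ ⟩
        0#                                            ∎
      coeff-g≠ : ∀ ν → coeff nrm g≠ ν ≈ 0#
      coeff-g≠ ν with ≡-dec ℕP._≟_ ν₀ ν
      ... | yes P.refl = coeff-g≠-ν₀
      ... | no ν₀≢ν = begin
        coeff nrm g≠ ν                          ≈⟨ +-identityˡ _ ⟨
        0# + coeff nrm g≠ ν                     ≈⟨ +-cong coeff-g₌-ν≈0 refl ⟨
        coeff nrm g₌ ν + coeff nrm g≠ ν         ≈⟨ ∑-partition same g _ ⟨
        coeff nrm g ν                           ≈⟨ +-identityˡ _ ⟨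
        0# + coeff nrm g ν                      ≈⟨ +-cong (reflexive (P.cong (λ b → when b a) (δ-≢ nrm ν k ν₀≢ν))) refl ⟨
        coeff nrm ((a , k) ∷ g) ν               ≈⟨ coeff≈0 ν ⟩
        0#                                      ∎
        where
        coeff-g₌-ν≈0 : coeff nrm g₌ ν ≈ 0#
        coeff-g₌-ν≈0 = ∑-zero-All (All.map (λ {q} t → reflexive (P.cong (λ b → when b (proj₁ q))
          (δ-≢ nrm ν (proj₂ q) (λ e → ν₀≢ν (P.trans (P.sym (δ-true⇒≡ nrm ν₀ (proj₂ q) (T⇒≡true t))) e))))) g₌-same)
      ∫g≠ : ∫ g≠ (φ ∘ nrm) ≈ 0#
      ∫g≠ = coeff-zero⇒∫-zero n g≠ (ℕP.≤-trans (length-filter (T? ∘ not ∘ same) g) ∣g∣≤n) coeff-g≠ φ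

    ∫-resp-coeff : ∀ g h → (∀ ν → coeff nrm g ν ≈ coeff nrm h ν) →
                   ∀ ψ → (∀ k → ψ k ≈ ψ (nrm k)) → ∫ g ψ ≈ ∫ h ψ
    ∫-resp-coeff g h g≈h ψ ψ-inv = begin
      ∫ g ψ           ≈⟨ ∫-cong g ψ-inv ⟩
      ∫ g (ψ ∘ nrm)   ≈⟨ x∙y⁻¹≈ε⇒x≈y _ _ difference ⟩
      ∫ h (ψ ∘ nrm)   ≈⟨ ∫-cong h ψ-inv ⟨
      ∫ h ψ           ∎
      where
      difference : ∫ g (ψ ∘ nrm) + - ∫ h (ψ ∘ nrm) ≈ 0#
      difference = begin
        ∫ g (ψ ∘ nrm) + - ∫ h (ψ ∘ nrm)   ≈⟨ +-cong refl (∫-neg h (ψ ∘ nrm)) ⟨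
        ∫ g (ψ ∘ nrm) + ∫ (neg h) (ψ ∘ nrm) ≈⟨ ∫-++ g (neg h) (ψ ∘ nrm) ⟨
        ∫ (g ++ neg h) (ψ ∘ nrm)           ≈⟨ coeff-zero⇒∫-zero _ (g ++ neg h) ℕP.≤-refl coeff≈0 ψ ⟩
        0#                                 ∎
        where
        coeff≈0 : ∀ ν → coeff nrm (g ++ neg h) ν ≈ 0#
        coeff≈0 ν = trans (coeff-++ nrm g (neg h) ν) (trans (+-cong refl (coeff-neg nrm h ν)) (x≈y⇒x∙y⁻¹≈ε (g≈h ν)))

-- Keys pair like complete homogeneous functions, ⟨e_κ , e_ρ⟩ = ⟨h_κ , h_ρ⟩ = matCount κ ρ, and
-- the adjoint of multiplication by the power sum p_n removes n from one part of κ.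
module PowerSums {c ℓ} (F : Field c ℓ) where

  open import Data.Nat as ℕ using (ℕ; zero; suc; _∸_; _≤ᵇ_; _≤_; _<_; z≤n; s≤s)
  import Data.Nat.Properties as ℕP
  open import Data.List using ([]; _∷_; _++_; map; concatMap; upTo)
  open import Data.List.Relation.Unary.All as All using (All; []; _∷_)
  open import Data.List.Relation.Unary.All.Properties using (applyUpTo⁺₁)
  open import Data.Bool using (true; false)
  open import Data.Product using (_,_; proj₁; proj₂)
  open import Function using (_∘_; id)
  open import Relation.Binary.PropositionalEquality as P using (_≡_)
  open BoolComparison
  open Compositions
  open MatrixCount using (_∸ᵛ_; residues; matCount-++; matCount-[])
  open Subtractions
  open Coefficients F
  open import Relation.Binary.Reasoning.Setoid setoid

  ∑-subtractFromPart-∷ : ∀ n k κ (φ : Key → Carrier) →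
    ∑ (subtractFromPart n (k ∷ κ)) φ ≈ when (n ≤ᵇ k) (φ ((k ∸ n) ∷ κ)) + ∑ (subtractFromPart n κ) (φ ∘ (k ∷_))
  ∑-subtractFromPart-∷ n k κ φ with n ≤ᵇ k
  ... | true  = +-cong refl (reflexive (∑-map (subtractFromPart n κ) (k ∷_) φ))
  ... | false = trans (reflexive (∑-map (subtractFromPart n κ) (k ∷_) φ)) (sym (+-identityˡ _))

  ⟦countAtLeast-∷⟧ : ∀ i y s → ⟦ countAtLeast i (y ∷ s) ⟧ ≈ when (i ≤ᵇ y) 1# + ⟦ countAtLeast i s ⟧
  ⟦countAtLeast-∷⟧ i y s with i ≤ᵇ y
  ... | true  = refl
  ... | false = sym (+-identityˡ _)

  -- (s, r) ↦ s + i·δᵣ matches a column s of height q followed by the removal of i from row r with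
  -- the columns of height q + i, each counted once for every row where its entry is at least i.
  ∑-comps-subtractFromPart : ∀ κ q i (φ : Key → Carrier) → 1 ≤ i →
    ∑ (comps q κ) (λ s → ∑ (subtractFromPart i (κ ∸ᵛ s)) φ) ≈
    ∑ (comps (q ℕ.+ i) κ) (λ s → ⟦ countAtLeast i s ⟧ * φ (κ ∸ᵛ s))
  ∑-comps-subtractFromPart []      zero    (suc i) φ _   = +-identityʳ _
  ∑-comps-subtractFromPart []      (suc q) (suc i) φ _   = refl
  ∑-comps-subtractFromPart (k ∷ κ) q       i       φ 1≤i = begin
    ∑ (comps q (k ∷ κ)) (λ s → ∑ (subtractFromPart i ((k ∷ κ) ∸ᵛ s)) φ)
      ≈⟨ ∑-comps q k κ _ ⟩
    ∑ (range k q) (λ x → ∑ (comps (q ∸ x) κ) (λ s → ∑ (subtractFromPart i ((k ∸ x) ∷ κ ∸ᵛ s)) φ))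
      ≈⟨ ∑-cong (range k q) lhs-row ⟩
    ∑ (range k q) (λ x → when (i ≤ᵇ k ∸ x) (first-row (x ℕ.+ i)) + later-rows x (q ∸ x ℕ.+ i))
      ≈⟨ ∑-+ (range k q) _ _ ⟩
    ∑ (range k q) (λ x → when (i ≤ᵇ k ∸ x) (first-row (x ℕ.+ i))) + ∑ (range k q) (λ x → later-rows x (q ∸ x ℕ.+ i))
      ≈⟨ +-cong shift-first-row shift-later-rows ⟩
    ∑ (range k q+i) (λ y → when (i ≤ᵇ y) (first-row y)) + ∑ (range k q+i) (λ y → later-rows y (q+i ∸ y))
      ≈⟨ ∑-+ (range k q+i) _ _ ⟨
    ∑ (range k q+i) (λ y → when (i ≤ᵇ y) (first-row y) + later-rows y (q+i ∸ y))
      ≈⟨ ∑-cong (range k q+i) rhs-row ⟨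
    ∑ (range k q+i) (λ y → ∑ (comps (q+i ∸ y) κ) (λ s → ⟦ countAtLeast i (y ∷ s) ⟧ * φ ((k ∸ y) ∷ κ ∸ᵛ s)))
      ≈⟨ ∑-comps q+i k κ _ ⟨
    ∑ (comps q+i (k ∷ κ)) (λ s → ⟦ countAtLeast i s ⟧ * φ ((k ∷ κ) ∸ᵛ s))
      ∎
    where
    q+i = q ℕ.+ i

    first-row : ℕ → Carrier
    first-row y = ∑ (comps (q+i ∸ y) κ) (λ s → φ ((k ∸ y) ∷ κ ∸ᵛ s))

    later-rows : ℕ → ℕ → Carrier
    later-rows y r = ∑ (comps r κ) (λ s → ⟦ countAtLeast i s ⟧ * φ ((k ∸ y) ∷ κ ∸ᵛ s))

    lhs-row : ∀ x → ∑ (comps (q ∸ x) κ) (λ s → ∑ (subtractFromPart i ((k ∸ x) ∷ κ ∸ᵛ s)) φ) ≈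
                    when (i ≤ᵇ k ∸ x) (first-row (x ℕ.+ i)) + later-rows x (q ∸ x ℕ.+ i)
    lhs-row x = begin
      ∑ C (λ s → ∑ (subtractFromPart i ((k ∸ x) ∷ κ ∸ᵛ s)) φ)
        ≈⟨ ∑-cong C (λ s → ∑-subtractFromPart-∷ i (k ∸ x) (κ ∸ᵛ s) φ) ⟩
      ∑ C (λ s → when (i ≤ᵇ k ∸ x) (φ ((k ∸ x ∸ i) ∷ κ ∸ᵛ s)) + ∑ (subtractFromPart i (κ ∸ᵛ s)) (φ ∘ ((k ∸ x) ∷_)))
        ≈⟨ ∑-+ C _ _ ⟩
      ∑ C (λ s → when (i ≤ᵇ k ∸ x) (φ ((k ∸ x ∸ i) ∷ κ ∸ᵛ s)))
        + ∑ C (λ s → ∑ (subtractFromPart i (κ ∸ᵛ s)) (φ ∘ ((k ∸ x) ∷_)))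
        ≈⟨ +-cong (sym (when-∑ (i ≤ᵇ k ∸ x) C _)) (∑-comps-subtractFromPart κ (q ∸ x) i (φ ∘ ((k ∸ x) ∷_)) 1≤i) ⟩
      when (i ≤ᵇ k ∸ x) (∑ C (λ s → φ ((k ∸ x ∸ i) ∷ κ ∸ᵛ s))) + later-rows x (q ∸ x ℕ.+ i)
        ≈⟨ +-cong (reflexive (P.cong₂ (λ r a → when (i ≤ᵇ k ∸ x) (∑ (comps r κ) (λ s → φ (a ∷ κ ∸ᵛ s))))
                                      (P.sym (+-∸-+ q i x)) (ℕP.∸-+-assoc k x i))) refl ⟩
      when (i ≤ᵇ k ∸ x) (first-row (x ℕ.+ i)) + later-rows x (q ∸ x ℕ.+ i)
        ∎
      where
      C = comps (q ∸ x) κ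
      +-∸-+ : ∀ q i x → q ℕ.+ i ∸ (x ℕ.+ i) ≡ q ∸ x
      +-∸-+ q i x = P.trans (P.cong₂ _∸_ (ℕP.+-comm q i) (ℕP.+-comm x i)) (ℕP.[m+n]∸[m+o]≡n∸o i q x)

    rhs-row : ∀ y → ∑ (comps (q+i ∸ y) κ) (λ s → ⟦ countAtLeast i (y ∷ s) ⟧ * φ ((k ∸ y) ∷ κ ∸ᵛ s)) ≈
                    when (i ≤ᵇ y) (first-row y) + later-rows y (q+i ∸ y)
    rhs-row y = begin
      ∑ C (λ s → ⟦ countAtLeast i (y ∷ s) ⟧ * φ ((k ∸ y) ∷ κ ∸ᵛ s))
        ≈⟨ ∑-cong C (λ s → trans (*-cong (⟦countAtLeast-∷⟧ i y s) refl)
                                (trans (distribʳ _ _ _) (+-cong (when-1* (i ≤ᵇ y) _) refl))) ⟩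
      ∑ C (λ s → when (i ≤ᵇ y) (φ ((k ∸ y) ∷ κ ∸ᵛ s)) + ⟦ countAtLeast i s ⟧ * φ ((k ∸ y) ∷ κ ∸ᵛ s))
        ≈⟨ ∑-+ C _ _ ⟩
      ∑ C (λ s → when (i ≤ᵇ y) (φ ((k ∸ y) ∷ κ ∸ᵛ s))) + later-rows y (q+i ∸ y)
        ≈⟨ +-cong (when-∑ (i ≤ᵇ y) C _) refl ⟨
      when (i ≤ᵇ y) (first-row y) + later-rows y (q+i ∸ y)
        ∎
      where C = comps (q+i ∸ y) κ

    shift-first-row : ∑ (range k q) (λ x → when (i ≤ᵇ k ∸ x) (first-row (x ℕ.+ i))) ≈
                      ∑ (range k q+i) (λ y → when (i ≤ᵇ y) (first-row y))
    shift-first-row = trans (∑-range k q _) (trans (∑-shift i k q first-row) (sym (∑-range k q+i _)))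

    later-rows-short : ∀ y r → r < i → later-rows y r ≈ 0#
    later-rows-short y r r<i = ∑-zero-All (All.map (λ {s} (_ , Σs) →
      trans (*-cong (reflexive (P.cong ⟦_⟧ (countAtLeast-sum< i s (P.subst (_< i) (P.sym Σs) r<i)))) refl) (zeroˡ _)) (comps-sound r κ))

    later-rows-bound : ∀ y → when (y ≤ᵇ q) (later-rows y (q ∸ y ℕ.+ i)) ≈ when (y ≤ᵇ q+i) (later-rows y (q+i ∸ y))
    later-rows-bound y with y ≤ᵇ q in e₁
    ... | true = below (≤ᵇ-true⇒≤ y q e₁)
      where
      below : y ≤ q → later-rows y (q ∸ y ℕ.+ i) ≈ when (y ≤ᵇ q+i) (later-rows y (q+i ∸ y))
      below y≤q rewrite ≤⇒≤ᵇ-true {y} {q+i} (ℕP.≤-trans y≤q (ℕP.m≤m+n q i)) =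
        reflexive (P.cong (later-rows y) (P.sym (ℕP.+-∸-comm i y≤q)))
    ... | false with y ≤ᵇ q+i in e₂
    ...   | false = refl
    ...   | true  = sym (later-rows-short y (q+i ∸ y) q+i∸y<i)
      where
      q<y : q < y
      q<y = ℕP.≰⇒> (≤ᵇ-false⇒≰ y q e₁)
      q+i∸y<i : q+i ∸ y < i
      q+i∸y<i = ℕP.+-cancelʳ-< y (q+i ∸ y) i
        (P.subst (ℕ._< i ℕ.+ y) (P.sym (ℕP.m∸n+n≡m (≤ᵇ-true⇒≤ y q+i e₂)))
                 (P.subst (q+i ℕ.<_) (ℕP.+-comm y i) (ℕP.+-monoˡ-< i q<y)))

    shift-later-rows : ∑ (range k q) (λ x → later-rows x (q ∸ x ℕ.+ i)) ≈ ∑ (range k q+i) (λ y → later-rows y (q+i ∸ y))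
    shift-later-rows = trans (∑-range k q _) (trans (∑-cong (upTo (suc k)) later-rows-bound) (sym (∑-range k q+i _)))

  newtonTail : ℕ → Key → (Key → Carrier) → Carrier
  newtonTail m κ φ = ∑ (upTo m) (λ j → ∑ (comps (m ∸ j) κ) (λ s → ∑ (subtractFromPart (suc j) (κ ∸ᵛ s)) φ))

  -- Summing ∑-comps-subtractFromPart over i = 1, …, n, using Σᵢ countAtLeast i s = n for a column s of height n.
  newton-identity : ∀ m κ φ →
    ⟦ suc m ⟧ * ∑ (comps (suc m) κ) (λ s → φ (κ ∸ᵛ s)) ≈ ∑ (subtractFromPart (suc m) κ) φ + newtonTail m κ φ
  newton-identity m κ φ = begin
    ⟦ n ⟧ * ∑ C (λ s → φ (κ ∸ᵛ s))
      ≈⟨ ∑-*ˡ C ⟦ n ⟧ _ ⟨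
    ∑ C (λ s → ⟦ n ⟧ * φ (κ ∸ᵛ s))
      ≈⟨ ∑-cong-All (All.map (λ {s} s∈C → trans (sym (distribʳ _ _ _)) (*-cong (counts s s∈C) refl)) (comps-sound n κ)) ⟨
    ∑ C (λ s → ⟦ countAtLeast n s ⟧ * φ (κ ∸ᵛ s) + ∑ (upTo m) (λ j → ⟦ countAtLeast (suc j) s ⟧) * φ (κ ∸ᵛ s))
      ≈⟨ ∑-+ C _ _ ⟩
    ∑ C (λ s → ⟦ countAtLeast n s ⟧ * φ (κ ∸ᵛ s))
      + ∑ C (λ s → ∑ (upTo m) (λ j → ⟦ countAtLeast (suc j) s ⟧) * φ (κ ∸ᵛ s))
      ≈⟨ +-cong subtract-n subtract-below-n ⟨
    ∑ (subtractFromPart n κ) φ + newtonTail m κ φ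
      ∎
    where
    n = suc m
    C = comps n κ
    subtract-n : ∑ (subtractFromPart n κ) φ ≈ ∑ C (λ s → ⟦ countAtLeast n s ⟧ * φ (κ ∸ᵛ s))
    subtract-n = begin
      ∑ (subtractFromPart n κ) φ
        ≡⟨ P.cong (λ κ′ → ∑ (subtractFromPart n κ′) φ) (zipWith-∸-zeros κ) ⟨
      ∑ (subtractFromPart n (κ ∸ᵛ zeros κ)) φ
        ≈⟨ +-identityʳ _ ⟨
      ∑ (zeros κ ∷ []) (λ s → ∑ (subtractFromPart n (κ ∸ᵛ s)) φ)
        ≡⟨ P.cong (λ S → ∑ S (λ s → ∑ (subtractFromPart n (κ ∸ᵛ s)) φ)) (comps-0 κ) ⟨
      ∑ (comps 0 κ) (λ s → ∑ (subtractFromPart n (κ ∸ᵛ s)) φ)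
        ≈⟨ ∑-comps-subtractFromPart κ 0 n φ (s≤s z≤n) ⟩
      ∑ C (λ s → ⟦ countAtLeast n s ⟧ * φ (κ ∸ᵛ s))
        ∎
    subtract-below-n : newtonTail m κ φ ≈ ∑ C (λ s → ∑ (upTo m) (λ j → ⟦ countAtLeast (suc j) s ⟧) * φ (κ ∸ᵛ s))
    subtract-below-n = begin
      newtonTail m κ φ
        ≈⟨ ∑-cong-All (applyUpTo⁺₁ id m λ {j} j<m → trans (∑-comps-subtractFromPart κ (m ∸ j) (suc j) φ (s≤s z≤n))
             (reflexive (P.cong (λ r → ∑ (comps r κ) (λ s → ⟦ countAtLeast (suc j) s ⟧ * φ (κ ∸ᵛ s)))
                                (P.trans (ℕP.+-suc (m ∸ j) j) (P.cong suc (ℕP.m∸n+n≡m (ℕP.<⇒≤ j<m))))))) ⟩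
      ∑ (upTo m) (λ j → ∑ C (λ s → ⟦ countAtLeast (suc j) s ⟧ * φ (κ ∸ᵛ s)))
        ≈⟨ ∑-swap (upTo m) C _ ⟩
      ∑ C (λ s → ∑ (upTo m) (λ j → ⟦ countAtLeast (suc j) s ⟧ * φ (κ ∸ᵛ s)))
        ≈⟨ ∑-cong C (λ s → ∑-*ʳ (upTo m) (φ (κ ∸ᵛ s)) _) ⟩
      ∑ C (λ s → ∑ (upTo m) (λ j → ⟦ countAtLeast (suc j) s ⟧) * φ (κ ∸ᵛ s))
        ∎
    counts : ∀ s → IsComposition n κ s → ⟦ countAtLeast n s ⟧ + ∑ (upTo m) (λ j → ⟦ countAtLeast (suc j) s ⟧) ≈ ⟦ n ⟧
    counts s (_ , Σs≡n) = begin
      ⟦ countAtLeast n s ⟧ + ∑ (upTo m) (λ j → ⟦ countAtLeast (suc j) s ⟧) ≈⟨ +-comm _ _ ⟩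
      ∑ (upTo m) (λ j → ⟦ countAtLeast (suc j) s ⟧) + ⟦ countAtLeast n s ⟧ ≈⟨ ∑-upTo-∷ʳ m _ ⟨
      ∑ (upTo n) (λ j → ⟦ countAtLeast (suc j) s ⟧)
        ≈⟨ fromℕ-∑ (upTo n) (λ j → countAtLeast (suc j) s) ⟨
      ⟦ ℕ∑.∑ (upTo n) (λ j → countAtLeast (suc j) s) ⟧
        ≡⟨ P.cong ⟦_⟧ (P.trans (∑-countAtLeast n s s≤n) Σs≡n) ⟩
      ⟦ n ⟧ ∎
      where s≤n = P.subst (λ z → All (ℕ._≤ z) s) Σs≡n (All-≤-sum s)

  -- p_n written in the keys through Newton's identity n h_n = Σ_{i=1}^{n} p_i h_{n−i};
  -- the fuel f ≥ n only ensures termination.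
  powerSum : ℕ → ℕ → FS
  powerSum zero    n       = []
  powerSum (suc f) zero    = []
  powerSum (suc f) (suc m) =
    (⟦ suc m ⟧ , suc m ∷ []) ∷ neg (concatMap (λ j → eL (m ∸ j ∷ []) *L powerSum f (suc j)) (upTo m))

  residueSum : FS → Key → (Key → Carrier) → Carrier
  residueSum A κ φ = ∫ A (λ σ → ∑ (residues σ κ) φ)

  residueSum-e*L : ∀ b A κ φ → residueSum (eL (b ∷ []) *L A) κ φ ≈ ∑ (comps b κ) (λ s → residueSum A (κ ∸ᵛ s) φ)
  residueSum-e*L b A κ φ = begin
    residueSum (map bA A ++ []) κ φ
      ≈⟨ trans (∑-++ (map bA A) [] _) (+-identityʳ _) ⟩
    residueSum (map bA A) κ φ
      ≡⟨ ∑-map A bA _ ⟩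
    ∑ A (λ q → (1# * proj₁ q) * ∑ (residues (b ∷ proj₂ q) κ) φ)
      ≈⟨ ∑-cong A (λ q → *-cong (*-identityˡ _) (∑-concatMap (comps b κ) (λ s → residues (proj₂ q) (κ ∸ᵛ s)) φ)) ⟩
    ∑ A (λ q → proj₁ q * ∑ (comps b κ) (λ s → ∑ (residues (proj₂ q) (κ ∸ᵛ s)) φ))
      ≈⟨ ∑-cong A (λ q → ∑-*ˡ (comps b κ) (proj₁ q) _) ⟨
    ∑ A (λ q → ∑ (comps b κ) (λ s → proj₁ q * ∑ (residues (proj₂ q) (κ ∸ᵛ s)) φ))
      ≈⟨ ∑-swap A (comps b κ) _ ⟩
    ∑ (comps b κ) (λ s → residueSum A (κ ∸ᵛ s) φ)
      ∎
    where
    bA : Carrier × Key → Carrier × Key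
    bA q = (1# * proj₁ q , b ∷ proj₂ q)

  residueSum-powerSum : ∀ f m κ φ → suc m ≤ f → residueSum (powerSum f (suc m)) κ φ ≈ ∑ (subtractFromPart (suc m) κ) φ
  residueSum-powerSum (suc f) m κ φ (s≤s m<f) = begin
    ⟦ n ⟧ * ∑ (residues (n ∷ []) κ) φ + residueSum (neg lower) κ φ
      ≈⟨ +-cong (*-cong refl single-column) (∫-neg lower _) ⟩
    ⟦ n ⟧ * ∑ (comps n κ) (λ s → φ (κ ∸ᵛ s)) + - residueSum lower κ φ
      ≈⟨ +-cong (newton-identity m κ φ) (-‿cong lower-terms) ⟩
    (∑ (subtractFromPart n κ) φ + newtonTail m κ φ) + - newtonTail m κ φ
      ≈⟨ +-assoc _ _ _ ⟩
    ∑ (subtractFromPart n κ) φ + (newtonTail m κ φ + - newtonTail m κ φ)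
      ≈⟨ trans (+-cong refl (-‿inverseʳ _)) (+-identityʳ _) ⟩
    ∑ (subtractFromPart n κ) φ
      ∎
    where
    n = suc m
    lower = concatMap (λ j → eL (m ∸ j ∷ []) *L powerSum f (suc j)) (upTo m)
    single-column : ∑ (residues (n ∷ []) κ) φ ≈ ∑ (comps n κ) (λ s → φ (κ ∸ᵛ s))
    single-column = trans (∑-concatMap (comps n κ) (λ s → (κ ∸ᵛ s) ∷ []) φ) (∑-cong (comps n κ) (λ s → +-identityʳ _))
    lower-terms : residueSum lower κ φ ≈ newtonTail m κ φ
    lower-terms = begin
      residueSum lower κ φ
        ≈⟨ ∑-concatMap (upTo m) (λ j → eL (m ∸ j ∷ []) *L powerSum f (suc j)) _ ⟩
      ∑ (upTo m) (λ j → residueSum (eL (m ∸ j ∷ []) *L powerSum f (suc j)) κ φ)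
        ≈⟨ ∑-cong (upTo m) (λ j → residueSum-e*L (m ∸ j) (powerSum f (suc j)) κ φ) ⟩
      ∑ (upTo m) (λ j → ∑ (comps (m ∸ j) κ) (λ s → residueSum (powerSum f (suc j)) (κ ∸ᵛ s) φ))
        ≈⟨ ∑-cong-All (applyUpTo⁺₁ id m λ {j} j<m →
             ∑-cong (comps (m ∸ j) κ) (λ s → residueSum-powerSum f j (κ ∸ᵛ s) φ (ℕP.≤-trans j<m m<f))) ⟩
      newtonTail m κ φ
        ∎

  pairing : Key → FS → Carrier
  pairing κ y = ∫ y (λ ρ → ⟦ matCount κ ρ ⟧)

  pairing-*L : ∀ A Y κ → pairing κ (A *L Y) ≈ residueSum A κ (λ κ′ → pairing κ′ Y)
  pairing-*L []      Y κ = refl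
  pairing-*L (p ∷ A) Y κ = begin
    pairing κ (map pY Y ++ A *L Y)                           ≈⟨ ∑-++ (map pY Y) (A *L Y) _ ⟩
    pairing κ (map pY Y) + pairing κ (A *L Y)                ≈⟨ +-cong first-term (pairing-*L A Y κ) ⟩
    proj₁ p * ∑ R (λ κ′ → pairing κ′ Y) + residueSum A κ (λ κ′ → pairing κ′ Y) ∎
    where
    pY : Carrier × Key → Carrier × Key
    pY q = (proj₁ p * proj₁ q , proj₂ p ++ proj₂ q)
    R = residues (proj₂ p) κ
    first-term : pairing κ (map pY Y) ≈ proj₁ p * ∑ R (λ κ′ → pairing κ′ Y)
    first-term = begin
      pairing κ (map pY Y)
        ≡⟨ ∑-map Y pY _ ⟩
      ∑ Y (λ q → (proj₁ p * proj₁ q) * ⟦ matCount κ (proj₂ p ++ proj₂ q) ⟧)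
        ≈⟨ ∑-cong Y (λ q → trans (*-assoc _ _ _) (*-cong refl (*-cong refl
             (trans (reflexive (P.cong ⟦_⟧ (matCount-++ (proj₂ p) κ (proj₂ q)))) (fromℕ-∑ R _))))) ⟩
      ∑ Y (λ q → proj₁ p * (proj₁ q * ∑ R (λ κ′ → ⟦ matCount κ′ (proj₂ q) ⟧)))
        ≈⟨ ∑-*ˡ Y (proj₁ p) _ ⟩
      proj₁ p * ∑ Y (λ q → proj₁ q * ∑ R (λ κ′ → ⟦ matCount κ′ (proj₂ q) ⟧))
        ≈⟨ *-cong refl (trans (∑-cong Y (λ q → sym (∑-*ˡ R (proj₁ q) _))) (∑-swap Y R _)) ⟩
      proj₁ p * ∑ R (λ κ′ → pairing κ′ Y)
        ∎

  powerSumProduct : Key → FS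
  powerSumProduct []      = 1L
  powerSumProduct (n ∷ ν) = powerSum n n *L powerSumProduct ν

  pairing-powerSumProduct : ∀ ν → All (1 ≤_) ν → ∀ κ → pairing κ (powerSumProduct ν) ≈ ⟦ subtractionCount κ ν ⟧
  pairing-powerSumProduct []          []        κ =
    trans (+-identityʳ _) (trans (*-identityˡ _) (reflexive (P.cong ⟦_⟧ (matCount-[] κ))))
  pairing-powerSumProduct (suc m ∷ ν) (_ ∷ 1≤ν) κ = begin
    pairing κ (p *L powerSumProduct ν)                              ≈⟨ pairing-*L p (powerSumProduct ν) κ ⟩
    residueSum p κ (λ κ′ → pairing κ′ (powerSumProduct ν))          ≈⟨ residueSum-powerSum (suc m) m κ _ ℕP.≤-refl ⟩
    ∑ (subtractFromPart (suc m) κ) (λ κ′ → pairing κ′ (powerSumProduct ν))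
                                                                    ≈⟨ ∑-cong (subtractFromPart (suc m) κ) (pairing-powerSumProduct ν 1≤ν) ⟩
    ∑ (subtractFromPart (suc m) κ) (λ κ′ → ⟦ subtractionCount κ′ ν ⟧)          ≈⟨ fromℕ-∑ (subtractFromPart (suc m) κ) _ ⟨
    ⟦ subtractionCount κ (suc m ∷ ν) ⟧                                    ∎
    where p = powerSum (suc m) (suc m)


module Nondegeneracy {c ℓ} (F : Field c ℓ) (char0 : CharZero F) where

  open import Data.Nat as ℕ using (ℕ; suc; _<ᵇ_; _≤_; _<_)
  import Data.Nat.Properties as ℕP
  open import Data.List using (_++_; filterᵇ; length)
  open import Data.List.Properties using (≡-dec)
  open import Data.List.Relation.Unary.All as All using (All)
  open import Data.List.Relation.Unary.All.Properties using (all-filter)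
  open import Data.Bool using (Bool; true; false; not; T)
  open import Data.Product using (_×_; proj₁; proj₂)
  open import Data.Empty using (⊥-elim)
  open import Function using (_∘_)
  open import Relation.Binary.PropositionalEquality as P using (_≡_)
  open import Relation.Nullary using (¬_; yes; no)
  open import Relation.Nullary.Decidable using (T?)
  open import Relation.Binary using (tri<; tri≈; tri>)
  open Sorting using (normE-idem; normE-positive; positiveLength; length-normE)
  open MatrixCount using (matCount-normE)
  open Subtractions
  open Coefficients F
  open import Relation.Binary.Reasoning.Setoid setoid
  open PowerSums F

  Orthogonal : FS → Set ℓ
  Orthogonal g = ∀ ρ → ∫ g (λ k → ⟦ matCount k ρ ⟧) ≈ 0#

  orthogonal-pairing : ∀ g → Orthogonal g → ∀ y → ∫ g (λ k → pairing k y) ≈ 0#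
  orthogonal-pairing g g⊥ y = begin
    ∫ g (λ k → ∫ y (λ ρ → ⟦ matCount k ρ ⟧))   ≈⟨ ∫-swap g y _ ⟩
    ∫ y (λ ρ → ∫ g (λ k → ⟦ matCount k ρ ⟧))   ≈⟨ ∫-cong y g⊥ ⟩
    ∫ y (λ _ → 0#)                             ≈⟨ ∑-zero y (λ q → zeroʳ _) ⟩
    0#                                         ∎

  subtractionCount-normE : ∀ ν → All (1 ≤_) ν → ∀ k → ⟦ subtractionCount k ν ⟧ ≈ ⟦ subtractionCount (normE k) ν ⟧
  subtractionCount-normE ν 1≤ν k = begin
    ⟦ subtractionCount k ν ⟧               ≈⟨ pairing-powerSumProduct ν 1≤ν k ⟨
    pairing k (powerSumProduct ν)          ≈⟨ ∫-cong (powerSumProduct ν) (λ ρ → reflexive (P.cong ⟦_⟧ (matCount-normE k ρ))) ⟩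
    pairing (normE k) (powerSumProduct ν)  ≈⟨ pairing-powerSumProduct ν 1≤ν (normE k) ⟩
    ⟦ subtractionCount (normE k) ν ⟧       ∎

  coeff-non-normal : ∀ g ν → ¬ (normE ν ≡ ν) → coeff normE g ν ≈ 0#
  coeff-non-normal g ν ν≢normal = ∑-zero g λ q → reflexive (P.cong (λ b → when b (proj₁ q))
    (δ-≢ normE ν (proj₂ q) λ e → ν≢normal (P.trans (P.cong normE (P.sym e)) (P.trans (normE-idem (proj₂ q)) e))))

  -- The coefficient at a normal ν of length L is read off by pairing with p_ν: keys with fewer
  -- parts are handled by the induction hypothesis, keys with at least L parts pair to zero
  -- unless they normalise to ν.
  module InductionStep (g : FS) (g⊥ : Orthogonal g) (L : ℕ)
                       (IH : ∀ ν → length ν < L → coeff normE g ν ≈ 0#)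
                       (ν : Key) (ν-normal : normE ν ≡ ν) (∣ν∣≡L : length ν ≡ L) where

    1≤ν : All (1 ≤_) ν
    1≤ν = P.subst (All (1 ≤_)) ν-normal (normE-positive ν)

    short : Carrier × Key → Bool
    short q = positiveLength (proj₂ q) <ᵇ L

    g< = filterᵇ short g
    g≥ = filterᵇ (not ∘ short) g

    short⇒< : ∀ {q} → T (short q) → positiveLength (proj₂ q) < L
    short⇒< {q} = ℕP.<ᵇ⇒< (positiveLength (proj₂ q)) L

    long⇒≮ : ∀ {q} → T (not (short q)) → ¬ (positiveLength (proj₂ q) < L)
    long⇒≮ {q} t ℓ<L with short q | ℕP.<⇒<ᵇ ℓ<L
    ... | false | t′ = t′

    ψ : Key → Carrier
    ψ k = ⟦ subtractionCount k ν ⟧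

    coeff-g< : ∀ ν′ → coeff normE g< ν′ ≈ 0#
    coeff-g< ν′ with ℕP._<?_ (length ν′) L
    ... | yes ∣ν′∣<L = begin
      coeff normE g< ν′                          ≈⟨ +-identityʳ _ ⟨
      coeff normE g< ν′ + 0#                     ≈⟨ +-cong refl coeff-g≥ ⟨
      coeff normE g< ν′ + coeff normE g≥ ν′      ≈⟨ ∑-partition short g _ ⟨
      coeff normE g ν′                           ≈⟨ IH ν′ ∣ν′∣<L ⟩
      0#                                         ∎
      where
      coeff-g≥ : coeff normE g≥ ν′ ≈ 0#
      coeff-g≥ = ∑-zero-All (All.map (λ {q} t → reflexive (P.cong (λ b → when b (proj₁ q))
        (δ-≢ normE ν′ (proj₂ q) λ e → long⇒≮ {q} t
          (P.subst (_< L) (P.trans (P.cong length (P.sym e)) (length-normE (proj₂ q))) ∣ν′∣<L))))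
        (all-filter (T? ∘ not ∘ short) g))
    ... | no ∣ν′∣≮L = ∑-zero-All (All.map (λ {q} t → reflexive (P.cong (λ b → when b (proj₁ q))
        (δ-≢ normE ν′ (proj₂ q) λ e → ∣ν′∣≮L
          (P.subst (_< L) (P.trans (P.sym (length-normE (proj₂ q))) (P.cong length e)) (short⇒< {q} t)))))
        (all-filter (T? ∘ short) g))

    ∫g< : ∫ g< ψ ≈ 0#
    ∫g< = trans (∫-cong g< (subtractionCount-normE ν 1≤ν)) (coeff-zero⇒∫-zero normE _ g< ℕP.≤-refl coeff-g< ψ)

    ψ-long : ∀ k → ¬ (positiveLength k < L) → ψ k ≈ when (δ normE ν k) ⟦ subtractionCount ν ν ⟧
    ψ-long k ℓ≮L with ≡-dec ℕP._≟_ (normE k) ν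
    ... | yes e = trans (subtractionCount-normE ν 1≤ν k) (reflexive (P.cong (λ z → ⟦ subtractionCount z ν ⟧) e))
    ... | no ≢ν with ℕP.<-cmp (positiveLength k) L
    ...   | tri< ℓ<L _ _ = ⊥-elim (ℓ≮L ℓ<L)
    ...   | tri> _ _ ℓ>L =
      reflexive (P.cong ⟦_⟧ (subtractionCount-vanishes ν 1≤ν k (P.subst (ℕ._< positiveLength k) (P.sym ∣ν∣≡L) ℓ>L)))
    ...   | tri≈ _ ℓ≡L _ with subtractionCount k ν ℕP.≟ 0
    ...     | yes ≡0 = reflexive (P.cong ⟦_⟧ ≡0)
    ...     | no ≢0  =
      ⊥-elim (≢ν (P.trans (subtractionCount≢0⇒normE≡ ν 1≤ν k (P.trans ℓ≡L (P.sym ∣ν∣≡L)) ≢0) ν-normal))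

    ∫g≥ : ∫ g≥ ψ ≈ coeff normE g≥ ν * ⟦ subtractionCount ν ν ⟧
    ∫g≥ = trans (∑-cong-All (All.map (λ {q} t → trans (*-cong refl (ψ-long (proj₂ q) (long⇒≮ {q} t)))
                                                      (*-when (δ normE ν (proj₂ q)) (proj₁ q) _))
                                     (all-filter (T? ∘ not ∘ short) g)))
                (∑-*ʳ g≥ _ _)
      where
      *-when : ∀ b a v → a * when b v ≈ when b a * v
      *-when true  a v = refl
      *-when false a v = trans (zeroʳ a) (sym (zeroˡ v))

    coeff-g : coeff normE g ν ≈ coeff normE g≥ ν
    coeff-g = begin
      coeff normE g ν                        ≈⟨ ∑-partition short g _ ⟩
      coeff normE g< ν + coeff normE g≥ ν    ≈⟨ +-cong (coeff-g< ν) refl ⟩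
      0# + coeff normE g≥ ν                  ≈⟨ +-identityˡ _ ⟩
      coeff normE g≥ ν                       ∎

    coeff-g≈0 : coeff normE g ν ≈ 0#
    coeff-g≈0 = x*y≈0⇒x≈0 (begin
      coeff normE g ν * ⟦ subtractionCount ν ν ⟧   ≈⟨ *-cong coeff-g refl ⟩
      coeff normE g≥ ν * ⟦ subtractionCount ν ν ⟧  ≈⟨ ∫g≥ ⟨
      ∫ g≥ ψ                                       ≈⟨ +-identityˡ _ ⟨
      0# + ∫ g≥ ψ                                  ≈⟨ +-cong ∫g< refl ⟨
      ∫ g< ψ + ∫ g≥ ψ                              ≈⟨ ∑-partition short g _ ⟨
      ∫ g ψ                                        ≈⟨ ∫-cong g (pairing-powerSumProduct ν 1≤ν) ⟨
      ∫ g (λ k → pairing k (powerSumProduct ν))    ≈⟨ orthogonal-pairing g g⊥ (powerSumProduct ν) ⟩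
      0#                                           ∎)
      (char0⇒⟦n⟧≉0 char0 (subtractionCount ν ν) (subtractionCount-self ν 1≤ν))

  nondegenerate : ∀ g → Orthogonal g → ∀ ν → coeff normE g ν ≈ 0#
  nondegenerate g g⊥ ν = below (suc (length ν)) ν ℕP.≤-refl
    where
    below : ∀ L ν → length ν < L → coeff normE g ν ≈ 0#
    below (suc L) ν ∣ν∣<1+L with ℕP._<?_ (length ν) L | ≡-dec ℕP._≟_ (normE ν) ν
    ... | yes ∣ν∣<L | _            = below L ν ∣ν∣<L
    ... | no _      | no ≢ν        = coeff-non-normal g ν ≢ν
    ... | no ∣ν∣≮L  | yes ν-normal = InductionStep.coeff-g≈0 g g⊥ L (below L) ν ν-normal
                                   (ℕP.≤-antisym (ℕP.≤-pred ∣ν∣<1+L) (ℕP.≮⇒≥ ∣ν∣≮L))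

  pairing-injective : ∀ g h → (∀ ρ → ∫ g (λ k → ⟦ matCount k ρ ⟧) ≈ ∫ h (λ k → ⟦ matCount k ρ ⟧)) →
                      ∀ ν → coeff normE g ν ≈ coeff normE h ν
  pairing-injective g h g≈h ν = x∙y⁻¹≈ε⇒x≈y _ _ (begin
    coeff normE g ν + - coeff normE h ν      ≈⟨ +-cong refl (coeff-neg normE h ν) ⟨
    coeff normE g ν + coeff normE (neg h) ν  ≈⟨ coeff-++ normE g (neg h) ν ⟨
    coeff normE (g ++ neg h) ν               ≈⟨ nondegenerate (g ++ neg h) g-h⊥ ν ⟩
    0#                                       ∎)
    where
    g-h⊥ : Orthogonal (g ++ neg h)
    g-h⊥ ρ = trans (∫-++ g (neg h) _) (trans (+-cong refl (∫-neg h _)) (x≈y⇒x∙y⁻¹≈ε (g≈h ρ)))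

module Evaluation {c ℓ} (F : Field c ℓ) where

  open import Data.Nat using (ℕ; zero; suc)
  import Data.Nat.Properties as ℕP
  open import Data.List using ([]; _∷_; _++_; map; filterᵇ)
  open import Data.List.Properties using (≡-dec; ++-assoc)
  open import Data.List.Relation.Unary.All as All using (All; []; _∷_)
  open import Data.List.Relation.Unary.All.Properties using (all-filter)
  open import Data.List.Relation.Binary.Permutation.Propositional as Perm using (_↭_)
  open import Data.Bool using (Bool; true; false; not)
  open import Data.Product using (_×_; _,_; proj₁; proj₂)
  open import Function using (_∘_)
  open import Relation.Binary.Bundles using (Setoid)
  open import Relation.Binary.PropositionalEquality as P using (_≡_)
  open import Relation.Nullary using (yes; no; does)
  open import Relation.Nullary.Decidable using (T?)
  import Relation.Binary.Reasoning.Setoid as SetoidReasoning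
  open BoolComparison using (T⇒≡true; T-not⇒≡false)
  open Sorting using (Normaliser; normE-normaliser; sortD-normaliser; normE-↭; positive)
  open Coefficients F
  open SetoidReasoning setoid

  ι : (Key → Key) → Key → Key → Carrier
  ι nrm ν k = when (δ nrm ν k) 1#

  coeff≈∫ : ∀ nrm A ν → coeff nrm A ν ≈ ∫ A (ι nrm ν)
  coeff≈∫ nrm A ν = ∑-cong A (λ p → when-* (δ nrm ν (proj₂ p)) (proj₁ p))
    where
    when-* : ∀ b a → when b a ≈ a * when b 1#
    when-* true  a = sym (*-identityʳ a)
    when-* false a = sym (zeroʳ a)

  ∫-*L : ∀ A B φ → ∫ (A *L B) φ ≈ ∫ A (λ k → ∫ B (λ l → φ (k ++ l)))
  ∫-*L []      B φ = refl
  ∫-*L (p ∷ A) B φ = begin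
    ∫ (map pB B ++ A *L B) φ                                   ≈⟨ ∫-++ (map pB B) (A *L B) φ ⟩
    ∫ (map pB B) φ + ∫ (A *L B) φ                              ≡⟨ P.cong (_+ ∫ (A *L B) φ) (∑-map B pB _) ⟩
    ∑ B (λ q → (proj₁ p * proj₁ q) * φ (proj₂ p ++ proj₂ q)) + ∫ (A *L B) φ
                                                               ≈⟨ +-cong (trans (∑-cong B (λ q → *-assoc _ _ _)) (∑-*ˡ B (proj₁ p) _))
                                                                         (∫-*L A B φ) ⟩
    proj₁ p * ∫ B (λ l → φ (proj₂ p ++ l)) + ∫ A (λ k → ∫ B (λ l → φ (k ++ l))) ∎
    where
    pB : Carrier × Key → Carrier × Key
    pB q = (proj₁ p * proj₁ q , proj₂ p ++ proj₂ q)

  ∫-•L : ∀ a A φ → ∫ (a •L A) φ ≈ a * ∫ A φ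
  ∫-•L a A φ = trans (reflexive (∑-map A (λ q → (a * proj₁ q , proj₂ q)) _))
                     (trans (∑-cong A (λ q → *-assoc _ _ _)) (∑-*ˡ A a _))

  ∫-evL : ∀ V A φ → ∫ (evL V A) φ ≈ ∫ A (λ k → ∫ (prodL (map V k)) φ)
  ∫-evL V A φ = trans (∑-concatMap A (λ p → proj₁ p •L prodL (map V (proj₂ p))) _)
                      (∑-cong A (λ p → ∫-•L (proj₁ p) (prodL (map V (proj₂ p))) φ))

  ∫-1L : ∀ φ → ∫ 1L φ ≈ φ []
  ∫-1L φ = trans (+-identityʳ _) (*-identityˡ _)

  evL-++ : ∀ V A B → evL V (A ++ B) ≡ evL V A ++ evL V B
  evL-++ V []      B = P.refl
  evL-++ V (p ∷ A) B = P.trans (P.cong (term ++_) (evL-++ V A B)) (P.sym (++-assoc term _ _))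
    where term = proj₁ p •L prodL (map V (proj₂ p))

  evL-cong-≡ : ∀ {V W : ℕ → FS} A → All (λ p → All (λ j → V j ≡ W j) (proj₂ p)) A → evL V A ≡ evL W A
  evL-cong-≡         []      []       = P.refl
  evL-cong-≡ {V} {W} (p ∷ A) (e ∷ es) =
    P.cong₂ _++_ (P.cong (λ z → proj₁ p •L prodL z) (map-cong (proj₂ p) e)) (evL-cong-≡ A es)
    where
    map-cong : ∀ k → All (λ j → V j ≡ W j) k → map V k ≡ map W k
    map-cong []      []       = P.refl
    map-cong (j ∷ k) (e ∷ es) = P.cong₂ _∷_ e (map-cong k es)

  var : ℕ → FS
  var j = (1# , j ∷ []) ∷ []

  module Modulo (N : Normaliser) where
    open Normaliser N

    infix 4 _≈N_
    record _≈N_ (A B : FS) : Set ℓ where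
      constructor mkN
      field getN : ∀ ν → coeff nrm A ν ≈ coeff nrm B ν
    open _≈N_ public

    ≈N-refl : ∀ {A} → A ≈N A
    ≈N-refl = mkN λ ν → refl

    ≈N-sym : ∀ {A B} → A ≈N B → B ≈N A
    ≈N-sym A≈B = mkN λ ν → sym (getN A≈B ν)

    ≈N-trans : ∀ {A B C} → A ≈N B → B ≈N C → A ≈N C
    ≈N-trans A≈B B≈C = mkN λ ν → trans (getN A≈B ν) (getN B≈C ν)

    ≈N-setoid : Setoid c ℓ
    ≈N-setoid = record { Carrier = FS ; _≈_ = _≈N_
                       ; isEquivalence = record { refl = ≈N-refl ; sym = ≈N-sym ; trans = ≈N-trans } }

    module ≈N-Reasoning = SetoidReasoning ≈N-setoid

    ι-cong : ∀ ν {k l} → nrm k ≡ nrm l → ι nrm ν k ≡ ι nrm ν l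
    ι-cong ν e = P.cong (λ z → when (does (≡-dec ℕP._≟_ z ν)) 1#) e

    coeff-*L : ∀ A B ν → coeff nrm (A *L B) ν ≈ ∫ A (λ k → ∫ B (λ l → ι nrm ν (k ++ l)))
    coeff-*L A B ν = trans (coeff≈∫ nrm (A *L B) ν) (∫-*L A B _)

    coeff-•L : ∀ a A ν → coeff nrm (a •L A) ν ≈ a * coeff nrm A ν
    coeff-•L a A ν = trans (coeff≈∫ nrm (a •L A) ν) (trans (∫-•L a A _) (*-cong refl (sym (coeff≈∫ nrm A ν))))

    coeff-evL : ∀ (V : ℕ → FS) A ν → coeff nrm (evL V A) ν ≈ ∫ A (λ k → coeff nrm (prodL (map V k)) ν)
    coeff-evL V A ν = trans (coeff≈∫ nrm (evL V A) ν)
      (trans (∫-evL V A _) (∫-cong A (λ k → sym (coeff≈∫ nrm (prodL (map V k)) ν))))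

    ++-congN : ∀ {A A′ B B′} → A ≈N A′ → B ≈N B′ → A ++ B ≈N A′ ++ B′
    ++-congN {A} {A′} {B} {B′} A≈A′ B≈B′ = mkN λ ν →
      trans (coeff-++ nrm A B ν) (trans (+-cong (getN A≈A′ ν) (getN B≈B′ ν)) (sym (coeff-++ nrm A′ B′ ν)))

    neg-congN : ∀ {A B} → A ≈N B → neg A ≈N neg B
    neg-congN {A} {B} A≈B = mkN λ ν →
      trans (coeff-neg nrm A ν) (trans (-‿cong (getN A≈B ν)) (sym (coeff-neg nrm B ν)))

    •-congN : ∀ a {A B} → A ≈N B → a •L A ≈N a •L B
    •-congN a {A} {B} A≈B = mkN λ ν →
      trans (coeff-•L a A ν) (trans (*-cong refl (getN A≈B ν)) (sym (coeff-•L a B ν)))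

    -- Coefficients of a product only see the normal forms of the factors' keys.
    *-congˡN : ∀ {A A′} B → A ≈N A′ → A *L B ≈N A′ *L B
    *-congˡN {A} {A′} B A≈A′ = mkN λ ν → begin
      coeff nrm (A *L B) ν                          ≈⟨ coeff-*L A B ν ⟩
      ∫ A (λ k → ∫ B (λ l → ι nrm ν (k ++ l)))     ≈⟨ ∫-resp-coeff nrm A A′ (getN A≈A′) _
                                                         (λ k → ∫-cong B (λ l → reflexive (ι-cong ν (nrm-++ˡ k l)))) ⟩
      ∫ A′ (λ k → ∫ B (λ l → ι nrm ν (k ++ l)))    ≈⟨ coeff-*L A′ B ν ⟨
      coeff nrm (A′ *L B) ν                         ∎
      where
      nrm-++ˡ : ∀ k l → nrm (k ++ l) ≡ nrm (nrm k ++ l)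
      nrm-++ˡ k l = P.trans (nrm-++ k l) (P.trans (P.cong (λ z → nrm (z ++ nrm l)) (P.sym (nrm-idem k))) (P.sym (nrm-++ (nrm k) l)))

    *-congʳN : ∀ A {B B′} → B ≈N B′ → A *L B ≈N A *L B′
    *-congʳN A {B} {B′} B≈B′ = mkN λ ν → begin
      coeff nrm (A *L B) ν                          ≈⟨ coeff-*L A B ν ⟩
      ∫ A (λ k → ∫ B (λ l → ι nrm ν (k ++ l)))     ≈⟨ ∫-cong A (λ k → ∫-resp-coeff nrm B B′ (getN B≈B′) _
                                                         (λ l → reflexive (ι-cong ν (nrm-++ʳ k l)))) ⟩
      ∫ A (λ k → ∫ B′ (λ l → ι nrm ν (k ++ l)))    ≈⟨ coeff-*L A B′ ν ⟨
      coeff nrm (A *L B′) ν                         ∎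
      where
      nrm-++ʳ : ∀ k l → nrm (k ++ l) ≡ nrm (k ++ nrm l)
      nrm-++ʳ k l = P.trans (nrm-++ k l) (P.trans (P.cong (λ z → nrm (nrm k ++ z)) (P.sym (nrm-idem l))) (P.sym (nrm-++ k (nrm l))))

    *-congN : ∀ {A A′ B B′} → A ≈N A′ → B ≈N B′ → A *L B ≈N A′ *L B′
    *-congN {A} {A′} {B} {B′} A≈A′ B≈B′ = ≈N-trans (*-congˡN B A≈A′) (*-congʳN A′ B≈B′)

    *-commN : ∀ A B → A *L B ≈N B *L A
    *-commN A B = mkN λ ν → begin
      coeff nrm (A *L B) ν
        ≈⟨ coeff-*L A B ν ⟩
      ∫ A (λ k → ∫ B (λ l → ι nrm ν (k ++ l)))
        ≈⟨ ∫-swap A B _ ⟩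
      ∫ B (λ l → ∫ A (λ k → ι nrm ν (k ++ l)))
        ≈⟨ ∫-cong B (λ l → ∫-cong A (λ k → reflexive (ι-cong ν (nrm-comm k l)))) ⟩
      ∫ B (λ l → ∫ A (λ k → ι nrm ν (l ++ k)))
        ≈⟨ coeff-*L B A ν ⟨
      coeff nrm (B *L A) ν
        ∎

    *-assocN : ∀ A B C → (A *L B) *L C ≈N A *L (B *L C)
    *-assocN A B C = mkN λ ν → begin
      coeff nrm ((A *L B) *L C) ν                                  ≈⟨ coeff-*L (A *L B) C ν ⟩
      ∫ (A *L B) (λ k → ∫ C (λ m → ι nrm ν (k ++ m)))             ≈⟨ ∫-*L A B _ ⟩
      ∫ A (λ k → ∫ B (λ l → ∫ C (λ m → ι nrm ν ((k ++ l) ++ m))))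
        ≈⟨ ∫-cong A (λ k → ∫-cong B (λ l → ∫-cong C (λ m → reflexive (P.cong (ι nrm ν) (++-assoc k l m))))) ⟩
      ∫ A (λ k → ∫ B (λ l → ∫ C (λ m → ι nrm ν (k ++ (l ++ m)))))  ≈⟨ ∫-cong A (λ k → ∫-*L B C _) ⟨
      ∫ A (λ k → ∫ (B *L C) (λ r → ι nrm ν (k ++ r)))             ≈⟨ coeff-*L A (B *L C) ν ⟨
      coeff nrm (A *L (B *L C)) ν                                  ∎

    *-identityˡN : ∀ A → 1L *L A ≈N A
    *-identityˡN A = mkN λ ν →
      trans (coeff-*L 1L A ν) (trans (∫-1L (λ k → ∫ A (λ l → ι nrm ν (k ++ l)))) (sym (coeff≈∫ nrm A ν)))

    *-identityʳN : ∀ A → A *L 1L ≈N A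
    *-identityʳN A = ≈N-trans (*-commN A 1L) (*-identityˡN A)

    •-• : ∀ a b A → a •L (b •L A) ≈N (a * b) •L A
    •-• a b A = mkN λ ν → trans (coeff-•L a (b •L A) ν)
      (trans (*-cong refl (coeff-•L b A ν)) (trans (sym (*-assoc _ _ _)) (sym (coeff-•L (a * b) A ν))))

    •-inverse : ∀ {a b} A → a * b ≈ 1# → a •L (b •L A) ≈N A
    •-inverse {a} {b} A ab≈1 = ≈N-trans (•-• a b A)
      (mkN λ ν → trans (coeff-•L (a * b) A ν) (trans (*-cong ab≈1 refl) (*-identityˡ _)))

    ++-++-neg : ∀ A B → (A ++ B) ++ neg B ≈N A
    ++-++-neg A B = mkN λ ν → begin
      coeff nrm ((A ++ B) ++ neg B) ν                          ≈⟨ coeff-++ nrm (A ++ B) (neg B) ν ⟩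
      coeff nrm (A ++ B) ν + coeff nrm (neg B) ν               ≈⟨ +-cong (coeff-++ nrm A B ν) (coeff-neg nrm B ν) ⟩
      (coeff nrm A ν + coeff nrm B ν) + - coeff nrm B ν        ≈⟨ +-assoc _ _ _ ⟩
      coeff nrm A ν + (coeff nrm B ν + - coeff nrm B ν)        ≈⟨ trans (+-cong refl (-‿inverseʳ _)) (+-identityʳ _) ⟩
      coeff nrm A ν                                            ∎

    ++-neg-++ : ∀ A B → (A ++ neg B) ++ B ≈N A
    ++-neg-++ A B = mkN λ ν → begin
      coeff nrm ((A ++ neg B) ++ B) ν                          ≈⟨ coeff-++ nrm (A ++ neg B) B ν ⟩
      coeff nrm (A ++ neg B) ν + coeff nrm B ν                 ≈⟨ +-cong (coeff-++ nrm A (neg B) ν) refl ⟩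
      (coeff nrm A ν + coeff nrm (neg B) ν) + coeff nrm B ν    ≈⟨ +-cong (+-cong refl (coeff-neg nrm B ν)) refl ⟩
      (coeff nrm A ν + - coeff nrm B ν) + coeff nrm B ν        ≈⟨ +-assoc _ _ _ ⟩
      coeff nrm A ν + (- coeff nrm B ν + coeff nrm B ν)        ≈⟨ trans (+-cong refl (-‿inverseˡ _)) (+-identityʳ _) ⟩
      coeff nrm A ν                                            ∎

    prodL-cong-All : ∀ (V W : ℕ → FS) k → All (λ j → V j ≈N W j) k → prodL (map V k) ≈N prodL (map W k)
    prodL-cong-All V W []      []       = ≈N-refl
    prodL-cong-All V W (j ∷ k) (e ∷ es) = *-congN e (prodL-cong-All V W k es)

    evL-cong-All : ∀ (V W : ℕ → FS) A → All (λ p → All (λ j → V j ≈N W j) (proj₂ p)) A → evL V A ≈N evL W A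
    evL-cong-All V W A es = mkN λ ν → trans (coeff-evL V A ν)
      (trans (∑-cong-All (All.map (λ {p} e → *-cong refl (getN (prodL-cong-All V W (proj₂ p) e) ν)) es))
             (sym (coeff-evL W A ν)))

    evL-cong : ∀ (V W : ℕ → FS) → (∀ j → V j ≈N W j) → ∀ A → evL V A ≈N evL W A
    evL-cong V W V≈W A = evL-cong-All V W A (All.tabulate λ {p} _ → All.tabulate λ {j} _ → V≈W j)

    prodL-++ : ∀ (V : ℕ → FS) k l → prodL (map V (k ++ l)) ≈N prodL (map V k) *L prodL (map V l)
    prodL-++ V []      l = ≈N-sym (*-identityˡN _)
    prodL-++ V (j ∷ k) l = ≈N-trans (*-congʳN (V j) (prodL-++ V k l)) (≈N-sym (*-assocN (V j) _ _))

    evL-*L : ∀ (V : ℕ → FS) A B → evL V (A *L B) ≈N evL V A *L evL V B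
    evL-*L V A B = mkN λ ν → begin
      coeff nrm (evL V (A *L B)) ν
        ≈⟨ coeff-evL V (A *L B) ν ⟩
      ∫ (A *L B) (λ k → coeff nrm (V^ k) ν)
        ≈⟨ ∫-*L A B _ ⟩
      ∫ A (λ k → ∫ B (λ l → coeff nrm (V^ (k ++ l)) ν))
        ≈⟨ ∫-cong A (λ k → ∫-cong B (λ l → trans (getN (prodL-++ V k l) ν) (coeff-*L (V^ k) (V^ l) ν))) ⟩
      ∫ A (λ k → ∫ B (λ l → ∫ (V^ k) (λ k′ → ∫ (V^ l) (λ l′ → ι nrm ν (k′ ++ l′)))))
        ≈⟨ ∫-cong A (λ k → ∫-swap B (V^ k) _) ⟩
      ∫ A (λ k → ∫ (V^ k) (λ k′ → ∫ B (λ l → ∫ (V^ l) (λ l′ → ι nrm ν (k′ ++ l′)))))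
        ≈⟨ ∫-cong A (λ k → ∫-cong (V^ k) (λ k′ → ∫-evL V B _)) ⟨
      ∫ A (λ k → ∫ (V^ k) (λ k′ → ∫ (evL V B) (λ l′ → ι nrm ν (k′ ++ l′))))
        ≈⟨ ∫-evL V A _ ⟨
      ∫ (evL V A) (λ k′ → ∫ (evL V B) (λ l′ → ι nrm ν (k′ ++ l′)))
        ≈⟨ coeff-*L (evL V A) (evL V B) ν ⟨
      coeff nrm (evL V A *L evL V B) ν
        ∎
      where
      V^ : Key → FS
      V^ k = prodL (map V k)

    evL-1L : ∀ (V : ℕ → FS) → evL V 1L ≈N 1L
    evL-1L V = mkN λ ν → trans (coeff-evL V 1L ν) (∫-1L (λ k → coeff nrm (prodL (map V k)) ν))

    evL-prodL : ∀ (V W : ℕ → FS) k → evL V (prodL (map W k)) ≈N prodL (map (λ j → evL V (W j)) k)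
    evL-prodL V W []      = evL-1L V
    evL-prodL V W (j ∷ k) = ≈N-trans (evL-*L V (W j) _) (*-congʳN (evL V (W j)) (evL-prodL V W k))

    evL-•L : ∀ (V : ℕ → FS) a A → evL V (a •L A) ≈N a •L evL V A
    evL-•L V a A = mkN λ ν → trans (coeff-evL V (a •L A) ν)
      (trans (∫-•L a A _) (trans (*-cong refl (sym (coeff-evL V A ν))) (sym (coeff-•L a (evL V A) ν))))

    evL-neg : ∀ (V : ℕ → FS) A → evL V (neg A) ≈N neg (evL V A)
    evL-neg V A = mkN λ ν → trans (coeff-evL V (neg A) ν)
      (trans (∫-neg A _) (trans (-‿cong (sym (coeff-evL V A ν))) (sym (coeff-neg nrm (evL V A) ν))))

    evL-evL : ∀ (V W : ℕ → FS) A → evL V (evL W A) ≈N evL (λ j → evL V (W j)) A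
    evL-evL V W A = mkN λ ν → begin
      coeff nrm (evL V (evL W A)) ν                                   ≈⟨ coeff-evL V (evL W A) ν ⟩
      ∫ (evL W A) (λ k → coeff nrm (prodL (map V k)) ν)               ≈⟨ ∫-evL W A _ ⟩
      ∫ A (λ k → ∫ (prodL (map W k)) (λ k′ → coeff nrm (prodL (map V k′)) ν))
        ≈⟨ ∫-cong A (λ k → trans (sym (coeff-evL V (prodL (map W k)) ν)) (getN (evL-prodL V W k) ν)) ⟩
      ∫ A (λ k → coeff nrm (prodL (map (λ j → evL V (W j)) k)) ν)     ≈⟨ coeff-evL _ A ν ⟨
      coeff nrm (evL (λ j → evL V (W j)) A) ν                         ∎

    prodL-var : ∀ k → prodL (map var k) ≈N (1# , k) ∷ []
    prodL-var []      = ≈N-refl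
    prodL-var (j ∷ k) = ≈N-trans (*-congʳN (var j) (prodL-var k))
      (mkN λ ν → +-cong (when-cong (δ nrm ν (j ∷ k)) (*-identityˡ _)) refl)

    evL-var : ∀ A → evL var A ≈N A
    evL-var A = mkN λ ν → begin
      coeff nrm (evL var A) ν                           ≈⟨ coeff-evL var A ν ⟩
      ∫ A (λ k → coeff nrm (prodL (map var k)) ν)       ≈⟨ ∫-cong A (λ k → trans (getN (prodL-var k) ν) (+-identityʳ _)) ⟩
      ∫ A (ι nrm ν)                                     ≈⟨ coeff≈∫ nrm A ν ⟨
      coeff nrm A ν                                     ∎

    evL-var-single : ∀ (V : ℕ → FS) j → evL V (var j) ≈N V j
    evL-var-single V j = mkN λ ν →
      trans (coeff-evL V (var j) ν) (trans (+-identityʳ _) (trans (*-identityˡ _) (getN (*-identityʳN (V j)) ν)))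

  module InΛ    = Modulo normE-normaliser
  module InPoly = Modulo sortD-normaliser

  ≈Λ⇒≈N : ∀ {A B} → _≈Λ_ F A B → A InΛ.≈N B
  ≈Λ⇒≈N {A} {B} A≈B = InΛ.mkN λ ν → trans (sym (coeffWith≈coeff normE A ν)) (trans (A≈B ν) (coeffWith≈coeff normE B ν))

  ≈N⇒≈Λ : ∀ {A B} → A InΛ.≈N B → _≈Λ_ F A B
  ≈N⇒≈Λ {A} {B} A≈B ν = trans (coeffWith≈coeff normE A ν) (trans (InΛ.getN A≈B ν) (sym (coeffWith≈coeff normE B ν)))

  prodL-resp-↭ : ∀ (V : ℕ → FS) {k k′} → k ↭ k′ → prodL (map V k) InPoly.≈N prodL (map V k′)
  prodL-resp-↭ V Perm.refl                  = InPoly.≈N-refl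
  prodL-resp-↭ V (Perm.prep x p)            = InPoly.*-congʳN (V x) (prodL-resp-↭ V p)
  prodL-resp-↭ V (Perm.swap {k} {k′} x y p) =
    InPoly.≈N-trans (InPoly.≈N-sym (InPoly.*-assocN (V x) (V y) _))
   (InPoly.≈N-trans (InPoly.*-congˡN _ (InPoly.*-commN (V x) (V y)))
   (InPoly.≈N-trans (InPoly.*-assocN (V y) (V x) _)
                    (InPoly.*-congʳN (V y) (InPoly.*-congʳN (V x) (prodL-resp-↭ V p)))))
  prodL-resp-↭ V (Perm.trans p q)           = InPoly.≈N-trans (prodL-resp-↭ V p) (prodL-resp-↭ V q)

  module _ (V : ℕ → FS) (V0≈1 : V 0 InPoly.≈N 1L) where

    prodL-normE : ∀ k → prodL (map V k) InPoly.≈N prodL (map V (normE k))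
    prodL-normE k = InPoly.≈N-sym (InPoly.≈N-trans (prodL-resp-↭ V (normE-↭ k)) (drop-zeros k))
      where
      drop-zeros : ∀ k → prodL (map V (filterᵇ positive k)) InPoly.≈N prodL (map V k)
      drop-zeros []          = InPoly.≈N-refl
      drop-zeros (zero ∷ k)  = InPoly.≈N-trans (drop-zeros k) (InPoly.≈N-sym (InPoly.≈N-trans
                                 (InPoly.*-congˡN (prodL (map V k)) V0≈1) (InPoly.*-identityˡN (prodL (map V k)))))
      drop-zeros (suc x ∷ k) = InPoly.*-congʳN (V (suc x)) (drop-zeros k)

    -- Since V respects e₀ = 1, the substitution e_j ↦ V j is well defined on Λ.
    evL-resp-≈Λ : ∀ A B → A InΛ.≈N B → evL V A InPoly.≈N evL V B
    evL-resp-≈Λ A B A≈B = InPoly.mkN λ κ → begin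
      coeff sortD (evL V A) κ                          ≈⟨ InPoly.coeff-evL V A κ ⟩
      ∫ A (λ k → coeff sortD (prodL (map V k)) κ)      ≈⟨ ∫-resp-coeff normE A B (InΛ.getN A≈B) _
                                                             (λ k → InPoly.getN (prodL-normE k) κ) ⟩
      ∫ B (λ k → coeff sortD (prodL (map V k)) κ)      ≈⟨ InPoly.coeff-evL V B κ ⟨
      coeff sortD (evL V B) κ                          ∎

  atKey : Key → Carrier × Key → Bool
  atKey ν₀ q = δ normE ν₀ (proj₂ q)

  split-off : ∀ ν₀ → normE ν₀ ≡ ν₀ → ∀ g → g InΛ.≈N (coeff normE g ν₀ •L eL ν₀) ++ filterᵇ (not ∘ atKey ν₀) g
  split-off ν₀ ν₀-normal g = InΛ.mkN λ ν → begin
    coeff normE g ν                                           ≈⟨ ∑-partition (atKey ν₀) g _ ⟩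
    coeff normE g₌ ν + coeff normE g≠ ν                       ≈⟨ +-cong (coeff-g₌ ν) refl ⟩
    when (δ normE ν ν₀) (coeff normE g ν₀) + coeff normE g≠ ν ≈⟨ +-cong (coeff-•eL ν) refl ⟨
    coeff normE (c₀ •L eL ν₀) ν + coeff normE g≠ ν            ≈⟨ coeff-++ normE (c₀ •L eL ν₀) g≠ ν ⟨
    coeff normE ((c₀ •L eL ν₀) ++ g≠) ν                       ∎
    where
    c₀ = coeff normE g ν₀
    g₌ = filterᵇ (atKey ν₀) g
    g≠ = filterᵇ (not ∘ atKey ν₀) g
    coeff-•eL : ∀ ν → coeff normE (c₀ •L eL ν₀) ν ≈ when (δ normE ν ν₀) c₀
    coeff-•eL ν = trans (+-identityʳ _) (when-cong (δ normE ν ν₀) (*-identityʳ _))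
    coeff-g≠-ν₀ : coeff normE g≠ ν₀ ≈ 0#
    coeff-g≠-ν₀ = ∑-zero-All (All.map (λ {q} t → reflexive (P.cong (λ b → when b (proj₁ q)) (T-not⇒≡false t)))
                                      (all-filter (T? ∘ not ∘ atKey ν₀) g))
    coeff-g₌ : ∀ ν → coeff normE g₌ ν ≈ when (δ normE ν ν₀) c₀
    coeff-g₌ ν with ≡-dec ℕP._≟_ ν₀ ν
    ... | yes P.refl = begin
      coeff normE g₌ ν₀                         ≈⟨ +-identityʳ _ ⟨
      coeff normE g₌ ν₀ + 0#                    ≈⟨ +-cong refl coeff-g≠-ν₀ ⟨
      coeff normE g₌ ν₀ + coeff normE g≠ ν₀     ≈⟨ ∑-partition (atKey ν₀) g _ ⟨
      c₀                                        ≡⟨ P.cong (λ b → when b c₀) (δ-≡ normE ν₀ ν₀ ν₀-normal) ⟨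
      when (δ normE ν₀ ν₀) c₀                   ∎
    ... | no ν₀≢ν = begin
      coeff normE g₌ ν         ≈⟨ ∑-zero-All (All.map (λ {q} t → reflexive (P.cong (λ b → when b (proj₁ q))
                                    (δ-≢ normE ν (proj₂ q) λ e →
                                       ν₀≢ν (P.trans (P.sym (δ-true⇒≡ normE ν₀ (proj₂ q) (T⇒≡true t))) e))))
                                    (all-filter (T? ∘ atKey ν₀) g)) ⟩
      0#                       ≡⟨ P.cong (λ b → when b c₀) (δ-≢ normE ν ν₀ λ e → ν₀≢ν (P.trans (P.sym ν₀-normal) e)) ⟨
      when (δ normE ν ν₀) c₀   ∎

module SkewExpansion {c ℓ} (F : Field c ℓ) (char0 : CharZero F) where

  open import Data.Nat using (ℕ)
  open import Data.List using (List; []; _∷_; _++_; map)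
  open import Data.Product using (_,_)
  import Relation.Binary.PropositionalEquality as P
  open MatrixCount using (residues; matCount-++)
  open Coefficients F
  open import Relation.Binary.Reasoning.Setoid setoid
  open Evaluation F
  open Nondegeneracy F char0 using (pairing-injective)

  -- e_{λ/μ} = Σ e_κ over the residues κ of λ after removing the columns μ.
  skewExpansion : List ℕ → List ℕ → FS
  skewExpansion lam mu = map (1# ,_) (residues mu lam)

  ∫-skewExpansion : ∀ lam mu φ → ∫ (skewExpansion lam mu) φ ≈ ∑ (residues mu lam) φ
  ∫-skewExpansion lam mu φ = trans (reflexive (∑-map (residues mu lam) (1# ,_) _)) (∑-cong (residues mu lam) (λ κ → *-identityˡ _))

  coeff-skewExpansion : ∀ lam mu ν → coeff normE (skewExpansion lam mu) ν ≈ ∑ (residues mu lam) (ι normE ν)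
  coeff-skewExpansion lam mu ν = reflexive (∑-map (residues mu lam) (1# ,_) _)

  ⟨-,eΛ⟩ : ∀ f ρ → ⟨_,_⟩ F f (eL ρ) ≈ ∫ f (λ k → ⟦ matCount k ρ ⟧)
  ⟨-,eΛ⟩ []            ρ = refl
  ⟨-,eΛ⟩ ((a , k) ∷ f) ρ = +-cong (*-cong (*-identityʳ a) refl) (⟨-,eΛ⟩ f ρ)

  skewE≈skewExpansion : ∀ lam mu u → IsSkewE F lam mu u → u InΛ.≈N skewExpansion lam mu
  skewE≈skewExpansion lam mu u u-skew = InΛ.mkN (pairing-injective u (skewExpansion lam mu) λ ρ → begin
    ∫ u (λ k → ⟦ matCount k ρ ⟧)                       ≈⟨ ⟨-,eΛ⟩ u ρ ⟨
    ⟨_,_⟩ F u (eL ρ)                                   ≈⟨ u-skew (eL ρ) ⟩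
    ⟨_,_⟩ F (eL lam) (eL mu *L eL ρ)                   ≈⟨ trans (+-identityʳ _)
                                                            (trans (*-cong (trans (*-identityˡ _) (*-identityˡ _)) refl) (*-identityˡ _)) ⟩
    ⟦ matCount lam (mu ++ ρ) ⟧                         ≡⟨ P.cong ⟦_⟧ (matCount-++ mu lam ρ) ⟩
    ⟦ ℕ∑.∑ (residues mu lam) (λ κ → matCount κ ρ) ⟧     ≈⟨ fromℕ-∑ (residues mu lam) _ ⟩
    ∑ (residues mu lam) (λ κ → ⟦ matCount κ ρ ⟧)        ≈⟨ ∫-skewExpansion lam mu _ ⟨
    ∫ (skewExpansion lam mu) (λ k → ⟦ matCount k ρ ⟧)   ∎)

module Parts where

  open import Data.Nat using (ℕ; zero; suc; _+_; _≤_; _<_; _≥_; z≤n; s≤s)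
  open import Data.Nat.Properties
  open import Data.Nat.ListAction using (sum)
  open import Data.Nat.ListAction.Properties using (sum-↭)
  open import Data.List using (List; []; _∷_; filterᵇ)
  open import Data.List.Relation.Unary.All as All using (All; []; _∷_)
  open import Data.List.Relation.Unary.All.Properties using (filter⁺)
  open import Data.List.Relation.Unary.Linked using (Linked; []; [-]; _∷_)
  open import Data.List.Relation.Binary.Pointwise using (Pointwise; []; _∷_)
  open import Data.List.Membership.Propositional using (_∈_)
  open import Data.List.Relation.Unary.Any using (here; there)
  open import Data.List.Relation.Binary.Permutation.Propositional using (↭-sym)
  open import Data.List.Relation.Binary.Permutation.Propositional.Properties using (All-resp-↭)
  open import Data.Sum using (_⊎_; inj₁; inj₂)
  open import Data.Product using (_,_)
  open import Data.Empty using (⊥-elim)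
  open import Function using (_∘_)
  open import Relation.Binary.PropositionalEquality
  open import Relation.Nullary using (yes; no)
  open import Relation.Nullary.Decidable using (T?)
  open Sorting
  open Compositions using (zeros)
  open MatrixCount using (IsResidue)
  open Subtractions using (All-≤-sum)
  open FiniteSum +-*-commutativeSemiring using (∑)

  All-≤-largest : ∀ l → Linked _≥_ l → All (_≤ largest l) l
  All-≤-largest []          []           = []
  All-≤-largest (x ∷ [])    [-]          = ≤-refl ∷ []
  All-≤-largest (x ∷ y ∷ l) (x≥y ∷ y∷l↓) = ≤-refl ∷ All.map (λ z≤y → ≤-trans z≤y x≥y) (All-≤-largest (y ∷ l) y∷l↓)

  Pointwise-All-≤ : ∀ {κ l B} → Pointwise _≤_ κ l → All (_≤ B) l → All (_≤ B) κ
  Pointwise-All-≤ []      []      = []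
  Pointwise-All-≤ (x ∷ p) (y ∷ a) = ≤-trans x y ∷ Pointwise-All-≤ p a

  All-normE : ∀ {P : ℕ → Set} {κ} → All P κ → All P (normE κ)
  All-normE {κ = κ} Pκ = All-resp-↭ (↭-sym (normE-↭ κ)) (filter⁺ (T? ∘ positive) Pκ)

  sum-normE : ∀ κ → sum (normE κ) ≡ sum κ
  sum-normE κ = trans (sum-↭ (normE-↭ κ)) (sum-positive κ)
    where
    sum-positive : ∀ κ → sum (filterᵇ positive κ) ≡ sum κ
    sum-positive []          = refl
    sum-positive (zero ∷ κ)  = sum-positive κ
    sum-positive (suc x ∷ κ) = cong (suc x +_) (sum-positive κ)

  normE-∷-zeros : ∀ m rest → 1 ≤ m → normE (m ∷ zeros rest) ≡ m ∷ []
  normE-∷-zeros (suc m) rest _ = cong (λ z → insertD (suc m) (sortD z)) (filter-zeros rest)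
    where
    filter-zeros : ∀ r → filterᵇ positive (zeros r) ≡ []
    filter-zeros []      = refl
    filter-zeros (x ∷ r) = filter-zeros r

  sum-zeros : ∀ r → sum (zeros r) ≡ 0
  sum-zeros []      = refl
  sum-zeros (x ∷ r) = sum-zeros r

  zeros-≤ : ∀ r → Pointwise _≤_ (zeros r) r
  zeros-≤ []      = []
  zeros-≤ (x ∷ r) = z≤n ∷ zeros-≤ r

  small-or-single : ∀ κ m → 1 ≤ m → sum κ ≡ m → All (_< m) κ ⊎ normE κ ≡ m ∷ []
  small-or-single []          m 1≤m Σ≡m = ⊥-elim (<⇒≢ 1≤m Σ≡m)
  small-or-single (zero ∷ κ)  m 1≤m Σ≡m with small-or-single κ m 1≤m Σ≡m
  ... | inj₁ small  = inj₁ (1≤m ∷ small)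
  ... | inj₂ single = inj₂ single
  small-or-single (suc x ∷ κ) m 1≤m Σ≡m with suc x <? m
  ... | yes x<m = inj₁ (x<m ∷ All.map (λ y≤Σκ → ≤-<-trans y≤Σκ Σκ<m) (All-≤-sum κ))
    where
    Σκ<m : sum κ < m
    Σκ<m = subst (sum κ <_) Σ≡m (m<n+m (sum κ) (s≤s z≤n))
  ... | no x≮m = inj₂ (trans (cong (λ z → insertD (suc x) (sortD z)) (sum≡0⇒filter≡[] κ Σκ≡0)) (cong (_∷ []) x≡m))
    where
    x≡m : suc x ≡ m
    x≡m = ≤-antisym (subst (suc x ≤_) Σ≡m (m≤m+n (suc x) (sum κ))) (≮⇒≥ x≮m)
    Σκ≡0 : sum κ ≡ 0
    Σκ≡0 = +-cancelˡ-≡ (suc x) (sum κ) 0 (trans Σ≡m (trans (sym x≡m) (sym (+-identityʳ (suc x)))))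
    sum≡0⇒filter≡[] : ∀ κ → sum κ ≡ 0 → filterᵇ positive κ ≡ []
    sum≡0⇒filter≡[] []         _ = refl
    sum≡0⇒filter≡[] (zero ∷ κ) e = sum≡0⇒filter≡[] κ e

  residue-sum : ∀ {mu lam κ j} → sum lam ≡ j + sum mu → IsResidue mu lam κ → sum κ ≡ j
  residue-sum {mu} {lam} {κ} {j} Σlam (_ , Σκ) = +-cancelʳ-≡ (sum mu) (sum κ) j (trans Σκ Σlam)

  residue-sum-normE : ∀ {mu lam κ j} → sum lam ≡ j + sum mu → IsResidue mu lam κ → sum (normE κ) ≡ j
  residue-sum-normE {mu} {lam} {κ} Σlam κ-res = trans (sum-normE κ) (residue-sum {mu} {lam} Σlam κ-res)

  ∈⇒≤∑ : ∀ {A : Set} (xs : List A) f {x} → x ∈ xs → f x ≤ ∑ xs f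
  ∈⇒≤∑ (x ∷ xs) f (here refl)  = m≤m+n _ _
  ∈⇒≤∑ (y ∷ xs) f (there x∈xs) = ≤-trans (∈⇒≤∑ xs f x∈xs) (m≤n+m _ _)

-- Reading off the coefficient of e_n is a derivation at the augmentation, so it vanishes on the
-- subalgebra generated by elements with no constant term and no e_n-term.
module LinearCoefficient {c ℓ} (F : Field c ℓ) (n : ℕ) (1≤n : 1 ≤ n) where

  open import Data.Nat as ℕ using (ℕ; suc; _≤_; _<_; _≥_; s≤s)
  import Data.Nat.Properties as ℕP
  open import Data.Nat.ListAction using (sum)
  open import Data.List using ([]; _∷_; _++_; map; length)
  open import Data.List.Properties using (≡-dec; ++-identityʳ; length-++)
  open import Data.List.Relation.Unary.All as All using (All; _∷_)
  open import Data.List.Relation.Unary.Linked using (Linked)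
  open import Data.List.Relation.Binary.Permutation.Propositional.Properties using (↭-length)
  open import Data.Bool using (Bool; false)
  open import Data.Product using (_,_; proj₂)
  open import Data.Empty using (⊥-elim)
  open import Relation.Binary.PropositionalEquality as P using (_≡_)
  open import Relation.Nullary using (¬_; does; yes; no)
  open Sorting using (sortD-↭; normE-++)
  open MatrixCount using (residues-sound; IsResidue)
  open Parts
  open Coefficients F
  open import Relation.Binary.Reasoning.Setoid setoid
  open Evaluation F

  linear constant : FS → Carrier
  linear   g = coeff normE g (n ∷ [])
  constant g = coeff normE g []

  private
    _≟ᴷ_ : Key → Key → Bool
    K ≟ᴷ K′ = does (≡-dec ℕP._≟_ K K′)

    ≟ᴷ-≢ : ∀ K K′ → ¬ K ≡ K′ → (K ≟ᴷ K′) ≡ false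
    ≟ᴷ-≢ K K′ K≢K′ with ≡-dec ℕP._≟_ K K′
    ... | yes K≡K′ = ⊥-elim (K≢K′ K≡K′)
    ... | no _     = P.refl

    long-≢[n] : ∀ K → 2 ≤ length K → ¬ K ≡ n ∷ []
    long-≢[n] K 2≤∣K∣ P.refl with 2≤∣K∣
    ... | s≤s ()

    sortD-≟[n] : ∀ K → (sortD K ≟ᴷ (n ∷ [])) ≡ (K ≟ᴷ (n ∷ []))
    sortD-≟[n] []            = P.refl
    sortD-≟[n] (y ∷ [])      = P.refl
    sortD-≟[n] (y ∷ z ∷ zs)  = P.trans
      (≟ᴷ-≢ _ _ (long-≢[n] (sortD (y ∷ z ∷ zs)) (P.subst (2 ≤_) (P.sym (↭-length (sortD-↭ (y ∷ z ∷ zs)))) 2≤)))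
      (P.sym (≟ᴷ-≢ _ _ (long-≢[n] (y ∷ z ∷ zs) 2≤)))
      where 2≤ = s≤s (s≤s ℕ.z≤n)

    when-sortD-++ : ∀ K L → when (sortD (K ++ L) ≟ᴷ (n ∷ [])) 1# ≈
      when (K ≟ᴷ []) 1# * when (L ≟ᴷ (n ∷ [])) 1# + when (K ≟ᴷ (n ∷ [])) 1# * when (L ≟ᴷ []) 1#
    when-sortD-++ [] [] = sym (trans (+-cong (*-identityˡ _) (zeroˡ _)) (+-identityʳ _))
    when-sortD-++ [] (y ∷ ys) = trans (reflexive (P.cong (λ b → when b 1#) (sortD-≟[n] (y ∷ ys))))
                                      (sym (trans (+-cong (*-identityˡ _) (zeroˡ _)) (+-identityʳ _)))
    when-sortD-++ (x ∷ xs) [] = trans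
      (reflexive (P.cong (λ b → when b 1#)
        (P.trans (P.cong (λ K → sortD K ≟ᴷ (n ∷ [])) (++-identityʳ (x ∷ xs))) (sortD-≟[n] (x ∷ xs)))))
      (sym (trans (+-cong (zeroˡ _) (*-identityʳ _)) (+-identityˡ _)))
    when-sortD-++ (x ∷ xs) (y ∷ ys) = trans
      (reflexive (P.cong (λ b → when b 1#) (≟ᴷ-≢ (sortD (x ∷ xs ++ y ∷ ys)) (n ∷ []) (long-≢[n] _ two≤))))
      (sym (trans (+-cong (zeroˡ _) (zeroʳ _)) (+-identityˡ _)))
      where
      two≤ : 2 ≤ length (sortD (x ∷ xs ++ y ∷ ys))
      two≤ = P.subst (2 ≤_) (P.sym (↭-length (sortD-↭ (x ∷ xs ++ y ∷ ys))))
               (P.subst (2 ≤_) (P.sym (length-++ (x ∷ xs))) (s≤s (ℕP.≤-trans (s≤s ℕ.z≤n) (ℕP.m≤n+m _ (length xs)))))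

  ι-++ : ∀ k l → ι normE (n ∷ []) (k ++ l) ≈ ι normE [] k * ι normE (n ∷ []) l + ι normE (n ∷ []) k * ι normE [] l
  ι-++ k l = trans (reflexive (P.cong (λ K → when (K ≟ᴷ (n ∷ [])) 1#) (normE-++ k l)))
                   (when-sortD-++ (normE k) (normE l))

  linear-* : ∀ A B → linear (A *L B) ≈ constant A * linear B + linear A * constant B
  linear-* A B = begin
    linear (A *L B)
      ≈⟨ InΛ.coeff-*L A B (n ∷ []) ⟩
    ∫ A (λ k → ∫ B (λ l → ι normE (n ∷ []) (k ++ l)))
      ≈⟨ ∫-cong A (λ k → trans (∫-cong B (ι-++ k)) (trans (∫-+ B _ _) (+-cong (∫-*ˡ B _ _) (∫-*ˡ B _ _)))) ⟩
    ∫ A (λ k → ι normE [] k * ∫ B (ι normE (n ∷ [])) + ι normE (n ∷ []) k * ∫ B (ι normE []))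
      ≈⟨ trans (∫-+ A _ _) (+-cong (∫-*ʳ A _ _) (∫-*ʳ A _ _)) ⟩
    ∫ A (ι normE []) * ∫ B (ι normE (n ∷ [])) + ∫ A (ι normE (n ∷ [])) * ∫ B (ι normE [])
      ≈⟨ +-cong (*-cong (coeff≈∫ normE A []) (coeff≈∫ normE B (n ∷ [])))
                (*-cong (coeff≈∫ normE A (n ∷ [])) (coeff≈∫ normE B [])) ⟨
    constant A * linear B + linear A * constant B
      ∎

  linear-evL : ∀ (v : ℕ → FS) → (∀ i → constant (v i) ≈ 0#) → (∀ i → linear (v i) ≈ 0#) → ∀ P → linear (evL v P) ≈ 0#
  linear-evL v const≈0 lin≈0 P =
    trans (InΛ.coeff-evL v P (n ∷ [])) (∑-zero P (λ p → trans (*-cong refl (linear-prodL (proj₂ p))) (zeroʳ _)))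
    where
    linear-prodL : ∀ k → linear (prodL (map v k)) ≈ 0#
    linear-prodL []      = +-identityʳ _
    linear-prodL (i ∷ k) = trans (linear-* (v i) (prodL (map v k)))
      (trans (+-cong (trans (*-cong (const≈0 i) refl) (zeroˡ _)) (trans (*-cong (lin≈0 i) refl) (zeroˡ _))) (+-identityʳ _))

  linear-e[n] : linear e[ n ] ≈ 1#
  linear-e[n] = trans (+-identityʳ _) (reflexive (P.cong (λ b → when b 1#) (δ-≡ normE (n ∷ []) (n ∷ []) (normE-singleton n 1≤n))))
    where
    normE-singleton : ∀ n → 1 ≤ n → normE (n ∷ []) ≡ n ∷ []
    normE-singleton (suc m) _ = P.refl

  module SkewTerms (char0 : CharZero F) where

    open SkewExpansion F char0

    constant-skewExpansion : ∀ lam mu j → 1 ≤ j → sum lam ≡ j ℕ.+ sum mu → constant (skewExpansion lam mu) ≈ 0#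
    constant-skewExpansion lam mu j 1≤j Σlam = trans (coeff-skewExpansion lam mu []) (∑-zero-All (All.map
      (λ {κ} κ-res → reflexive (P.cong (λ b → when b 1#) (δ-≢ normE [] κ λ normE≡[] →
         ℕP.<⇒≢ 1≤j (P.trans (P.sym (P.cong sum normE≡[])) (residue-sum-normE {mu} {lam} Σlam κ-res)))))
      (residues-sound mu lam)))

    linear-skewExpansion-small : ∀ lam mu → Linked _≥_ lam → largest lam < n → linear (skewExpansion lam mu) ≈ 0#
    linear-skewExpansion-small lam mu lam↓ lam₁<n = trans (coeff-skewExpansion lam mu (n ∷ [])) (∑-zero-All (All.map
      (λ {κ} κ-res → reflexive (P.cong (λ b → when b 1#) (δ-≢ normE (n ∷ []) κ (too-small κ κ-res))))
      (residues-sound mu lam)))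
      where
      too-small : ∀ κ → IsResidue mu lam κ → ¬ normE κ ≡ n ∷ []
      too-small κ (κ≤lam , _) normE≡[n] with P.subst (All (_≤ largest lam)) normE≡[n]
                                                (All-normE (Pointwise-All-≤ κ≤lam (All-≤-largest lam lam↓)))
      ... | n≤lam₁ ∷ _ = ℕP.<⇒≱ lam₁<n n≤lam₁

    linear-skewExpansion-degree : ∀ lam mu j → sum lam ≡ j ℕ.+ sum mu → ¬ j ≡ n → linear (skewExpansion lam mu) ≈ 0#
    linear-skewExpansion-degree lam mu j Σlam j≢n = trans (coeff-skewExpansion lam mu (n ∷ [])) (∑-zero-All (All.map
      (λ {κ} κ-res → reflexive (P.cong (λ b → when b 1#) (δ-≢ normE (n ∷ []) κ λ normE≡[n] →
         j≢n (P.trans (P.sym (residue-sum-normE {mu} {lam} Σlam κ-res)) (P.trans (P.cong sum normE≡[n]) (ℕP.+-identityʳ n))))))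
      (residues-sound mu lam)))

module Generators {c ℓ} (F : Field c ℓ) (char0 : CharZero F)
                  (lam mu : ℕ → List ℕ) (graded : IsGradedSkewSeq lam mu)
                  (u : ℕ → Λ F) (u-skew : ∀ n → IsSkewE F (lam n) (mu n) (u n)) where

  open import Data.Nat as ℕ using (zero; _<_; z≤n; s≤s)
  import Data.Nat.Properties as ℕP
  open import Data.Nat.ListAction using (sum)
  open import Data.List using ([]; _∷_; _++_; map; filterᵇ)
  open import Data.List.Relation.Unary.All as All using (All; []; _∷_)
  open import Data.List.Relation.Unary.All.Properties using (all-filter; filter⁺; map⁺)
  open import Data.List.Relation.Unary.Linked using (Linked)
  open import Data.List.Relation.Binary.Pointwise using (Pointwise; _∷_)
  open import Data.List.Membership.Propositional using (_∈_)
  open import Data.Bool using (true; not)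
  open import Data.Sum using (inj₁; inj₂)
  open import Data.Product using (_,_; proj₁; proj₂)
  open import Data.Empty using (⊥-elim)
  open import Function using (_∘_)
  open import Relation.Binary.PropositionalEquality as P using (_≡_)
  open import Relation.Nullary using (¬_; yes; no)
  open import Relation.Nullary.Decidable using (T?)
  open BoolComparison using (T-not⇒≡false)
  open Compositions using (zeros)
  open MatrixCount using (residues; residues-sound; residues-complete; IsResidue)
  open Parts
  open Coefficients F
  open Evaluation F
  open SkewExpansion F char0

  v : ℕ → FS
  v i = u (suc i)

  expansion : ℕ → FS
  expansion m = skewExpansion (lam m) (mu m)

  u≈expansion : ∀ n → u n InΛ.≈N expansion n
  u≈expansion n = skewE≈skewExpansion (lam n) (mu n) (u n) (u-skew n)

  Σlam : ∀ n → sum (lam n) ≡ n ℕ.+ sum (mu n)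
  Σlam n = proj₂ (proj₂ (graded n))

  lam↓ : ∀ n → Linked _≥_ (lam n)
  lam↓ n = proj₂ (proj₁ (graded n))

  generating⇒largest≥ : Generates F v → ∀ n → n ≥ 1 → largest (lam n) ≥ n
  generating⇒largest≥ gen n 1≤n with n ℕP.≤? largest (lam n)
  ... | yes n≤lam₁ = n≤lam₁
  ... | no  n≰lam₁ = ⊥-elim (0≉1 (begin
    0#                ≈⟨ linear-evL v constant-v linear-v P ⟨
    linear (evL v P)  ≈⟨ InΛ.getN (≈Λ⇒≈N {evL v P} {e[ n ]} evL-v-P≈e[n]) (n ∷ []) ⟩
    linear e[ n ]     ≈⟨ linear-e[n] ⟩
    1#                ∎))
    where
    open import Relation.Binary.Reasoning.Setoid setoid
    open LinearCoefficient F n 1≤n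
    open LinearCoefficient.SkewTerms F n 1≤n char0
    P = proj₁ (gen e[ n ])
    evL-v-P≈e[n] : _≈Λ_ F (evL v P) e[ n ]
    evL-v-P≈e[n] = proj₂ (gen e[ n ])
    constant-v : ∀ i → constant (v i) ≈ 0#
    constant-v i = trans (InΛ.getN (u≈expansion (suc i)) [])
                         (constant-skewExpansion (lam (suc i)) (mu (suc i)) (suc i) (s≤s z≤n) (Σlam (suc i)))
    linear-v : ∀ i → linear (v i) ≈ 0#
    linear-v i with suc i ℕP.≟ n
    ... | yes P.refl = trans (InΛ.getN (u≈expansion n) (n ∷ []))
                             (linear-skewExpansion-small (lam n) (mu n) (lam↓ n) (ℕP.≰⇒> n≰lam₁))
    ... | no  1+i≢n  = trans (InΛ.getN (u≈expansion (suc i)) (n ∷ []))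
                             (linear-skewExpansion-degree (lam (suc i)) (mu (suc i)) (suc i) (Σlam (suc i)) 1+i≢n)

  module _ (large : ∀ n → n ≥ 1 → largest (lam n) ≥ n) where

    leading : ℕ → Carrier
    leading m = coeff normE (expansion m) (m ∷ [])

    leadingCount : ℕ → ℕ
    leadingCount m = ℕ∑.∑ (residues (mu m) (lam m)) (λ κ → ℕ∑.when (δ normE (m ∷ []) κ) 1)

    leading≈count : ∀ m → leading m ≈ ⟦ leadingCount m ⟧
    leading≈count m = begin
      leading m                                         ≈⟨ coeff-skewExpansion (lam m) (mu m) (m ∷ []) ⟩
      ∑ R (ι normE (m ∷ []))                            ≈⟨ ∑-cong R (λ κ → trans (when-cong (δ normE (m ∷ []) κ) (sym (+-identityʳ 1#)))
                                                                                 (sym (fromℕ-when (δ normE (m ∷ []) κ) 1))) ⟩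
      ∑ R (λ κ → ⟦ ℕ∑.when (δ normE (m ∷ []) κ) 1 ⟧)    ≈⟨ fromℕ-∑ R _ ⟨
      ⟦ leadingCount m ⟧                                ∎
      where
      open import Relation.Binary.Reasoning.Setoid setoid
      R = residues (mu m) (lam m)

    -- The residue (m, 0, …, 0) exists because m ≤ λ₁ᵐ.
    leadingCount-positive : ∀ m → 1 ≤ m → 1 ≤ leadingCount m
    leadingCount-positive m 1≤m = via-first-part (lam m) P.refl
      where
      via-first-part : ∀ l → lam m ≡ l → 1 ≤ leadingCount m
      via-first-part []         lam-m = ⊥-elim (ℕP.<⇒≱ 1≤m (P.subst (λ l → m ≤ largest l) lam-m (large m 1≤m)))
      via-first-part (x ∷ rest) lam-m =
        ℕP.≤-trans (ℕP.≤-reflexive (P.sym (P.cong (λ b → ℕ∑.when b 1) t-leading)))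
                   (∈⇒≤∑ (residues (mu m) (lam m)) _ t∈residues)
        where
        t = m ∷ zeros rest
        t≤lam : Pointwise _≤_ t (lam m)
        t≤lam = P.subst (Pointwise _≤_ t) (P.sym lam-m)
                        (P.subst (λ l → m ≤ largest l) lam-m (large m 1≤m) ∷ zeros-≤ rest)
        Σt : sum (lam m) ≡ sum t ℕ.+ sum (mu m)
        Σt = P.trans (Σlam m)
          (P.cong (ℕ._+ sum (mu m)) (P.sym (P.trans (P.cong (m ℕ.+_) (sum-zeros rest)) (ℕP.+-identityʳ m))))
        t∈residues : t ∈ residues (mu m) (lam m)
        t∈residues = residues-complete (mu m) (lam m) t t≤lam Σt
        t-leading : δ normE (m ∷ []) t ≡ true
        t-leading = δ-≡ normE (m ∷ []) t (normE-∷-zeros m rest 1≤m)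

    leading≉0 : ∀ m → 1 ≤ m → ¬ (leading m ≈ 0#)
    leading≉0 m 1≤m leading≈0 =
      char0⇒⟦n⟧≉0 char0 (leadingCount m) (leadingCount-positive m 1≤m) (trans (sym (leading≈count m)) leading≈0)

    leading⁻¹ : ℕ → Carrier
    leading⁻¹ m = proj₁ (inverse (leading (suc m)) (leading≉0 (suc m) (s≤s z≤n)))

    leading*leading⁻¹ : ∀ m → leading (suc m) * leading⁻¹ m ≈ 1#
    leading*leading⁻¹ m = proj₂ (inverse (leading (suc m)) (leading≉0 (suc m) (s≤s z≤n)))

    rest : ℕ → FS
    rest m = filterᵇ (not ∘ atKey (m ∷ [])) (expansion m)

    expansion-split : ∀ m → expansion (suc m) InΛ.≈N ((leading (suc m) •L e[ suc m ]) ++ rest (suc m))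
    expansion-split m = split-off (suc m ∷ []) P.refl (expansion (suc m))

    rest-small : ∀ m → 1 ≤ m → All (λ q → All (_< m) (proj₂ q)) (rest m)
    rest-small m 1≤m = All.zipWith (λ {q} (t , q-res) → small q t q-res)
      (all-filter (T? ∘ not ∘ atKey (m ∷ [])) (expansion m) ,
       filter⁺ (T? ∘ not ∘ atKey (m ∷ [])) (map⁺ (residues-sound (mu m) (lam m))))
      where
      small : ∀ q → _ → IsResidue (mu m) (lam m) (proj₂ q) → All (_< m) (proj₂ q)
      small q t q-res with small-or-single (proj₂ q) m 1≤m (residue-sum {mu m} {lam m} (Σlam m) q-res)
      ... | inj₁ entries<m = entries<m
      ... | inj₂ single with P.trans (P.sym (δ-≡ normE (m ∷ []) (proj₂ q) single)) (T-not⇒≡false t)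
      ... | ()

    -- Triangular inversion: e_m = leading⁻¹ (u_m − rest_m), where rest_m only involves e_j with
    -- j < m; the fuel f ≥ m only ensures termination.
    Q : ℕ → ℕ → FS
    Q f       zero    = 1L
    Q zero    (suc m) = []
    Q (suc f) (suc m) = leading⁻¹ m •L (var m ++ neg (evL (Q f) (rest (suc m))))

    Q-fuel : ∀ f g j → j ≤ f → j ≤ g → Q f j ≡ Q g j
    Q-fuel f       g       zero    _         _         = P.refl
    Q-fuel (suc f) (suc g) (suc m) (s≤s m≤f) (s≤s m≤g) =
      P.cong (λ E → leading⁻¹ m •L (var m ++ neg E)) (evL-cong-≡ (rest (suc m))
        (All.map (All.map λ {j} j<1+m → Q-fuel f g j (ℕP.≤-trans (ℕP.≤-pred j<1+m) m≤f) (ℕP.≤-trans (ℕP.≤-pred j<1+m) m≤g))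
                 (rest-small (suc m) (s≤s z≤n))))

    q : ℕ → FS
    q j = Q j j

    evL-Q : ∀ f j → j ≤ f → evL v (Q f j) InΛ.≈N e[ j ]
    evL-Q f       zero    _         = InΛ.≈N-trans (InΛ.evL-1L v) (InΛ.mkN λ ν → refl)
    evL-Q (suc f) (suc m) (s≤s m≤f) = begin
      evL v (leading⁻¹ m •L (var m ++ neg E))
        ≈⟨ InΛ.evL-•L v (leading⁻¹ m) (var m ++ neg E) ⟩
      leading⁻¹ m •L evL v (var m ++ neg E)
        ≡⟨ P.cong (leading⁻¹ m •L_) (evL-++ v (var m) (neg E)) ⟩
      leading⁻¹ m •L (evL v (var m) ++ evL v (neg E))
        ≈⟨ InΛ.•-congN (leading⁻¹ m) (InΛ.++-congN evL-v-var evL-v-negE) ⟩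
      leading⁻¹ m •L (((leading (suc m) •L e) ++ rest (suc m)) ++ neg (rest (suc m)))
        ≈⟨ InΛ.•-congN (leading⁻¹ m) (InΛ.++-++-neg _ (rest (suc m))) ⟩
      leading⁻¹ m •L (leading (suc m) •L e)
        ≈⟨ InΛ.•-inverse e (trans (*-comm _ _) (leading*leading⁻¹ m)) ⟩
      e ∎
      where
      open InΛ.≈N-Reasoning
      e = e[ suc m ]
      E = evL (Q f) (rest (suc m))
      evL-v-var : evL v (var m) InΛ.≈N ((leading (suc m) •L e) ++ rest (suc m))
      evL-v-var = InΛ.≈N-trans (InΛ.evL-var-single v m) (InΛ.≈N-trans (u≈expansion (suc m)) (expansion-split m))
      evL-v-E : evL v E InΛ.≈N rest (suc m)
      evL-v-E = InΛ.≈N-trans (InΛ.evL-evL v (Q f) (rest (suc m)))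
        (InΛ.≈N-trans (InΛ.evL-cong-All (λ j → evL v (Q f j)) var (rest (suc m))
          (All.map (All.map λ {j} j<1+m → evL-Q f j (ℕP.≤-trans (ℕP.≤-pred j<1+m) m≤f))
                   (rest-small (suc m) (s≤s z≤n))))
          (InΛ.evL-var (rest (suc m))))
      evL-v-negE : evL v (neg E) InΛ.≈N neg (rest (suc m))
      evL-v-negE = InΛ.≈N-trans (InΛ.evL-neg v E) (InΛ.neg-congN evL-v-E)

    generates : Generates F v
    generates f = evL q f , ≈N⇒≈Λ (begin
      evL v (evL q f)            ≈⟨ InΛ.evL-evL v q f ⟩
      evL (λ j → evL v (q j)) f  ≈⟨ InΛ.evL-cong (λ j → evL v (q j)) var (λ j → evL-Q j j ℕP.≤-refl) f ⟩
      evL var f                  ≈⟨ InΛ.evL-var f ⟩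
      f                          ∎)
      where open InΛ.≈N-Reasoning

    q-inverts-v : ∀ i → evL q (v i) InPoly.≈N var i
    q-inverts-v i = begin
      evL q (v i)
        ≈⟨ evL-resp-≈Λ q InPoly.≈N-refl _ _ (InΛ.≈N-trans (u≈expansion (suc i)) (expansion-split i)) ⟩
      evL q ((leading (suc i) •L e[ suc i ]) ++ rest (suc i))
        ≡⟨ evL-++ q (leading (suc i) •L e[ suc i ]) (rest (suc i)) ⟩
      evL q (leading (suc i) •L e[ suc i ]) ++ evL q (rest (suc i))
        ≈⟨ InPoly.++-congN leading-term InPoly.≈N-refl ⟩
      (var i ++ neg (evL q (rest (suc i)))) ++ evL q (rest (suc i))
        ≈⟨ InPoly.++-neg-++ (var i) (evL q (rest (suc i))) ⟩
      var i ∎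
      where
      open InPoly.≈N-Reasoning
      rest-fuel : evL (Q i) (rest (suc i)) ≡ evL q (rest (suc i))
      rest-fuel = evL-cong-≡ (rest (suc i)) (All.map (All.map λ {j} j<1+i → Q-fuel i j j (ℕP.≤-pred j<1+i) ℕP.≤-refl)
                                                     (rest-small (suc i) (s≤s z≤n)))
      leading-term : evL q (leading (suc i) •L e[ suc i ]) InPoly.≈N var i ++ neg (evL q (rest (suc i)))
      leading-term = begin
        evL q (leading (suc i) •L e[ suc i ])
          ≈⟨ InPoly.evL-•L q (leading (suc i)) e[ suc i ] ⟩
        leading (suc i) •L evL q e[ suc i ]
          ≈⟨ InPoly.•-congN (leading (suc i)) (InPoly.evL-var-single q (suc i)) ⟩
        leading (suc i) •L (leading⁻¹ i •L (var i ++ neg (evL (Q i) (rest (suc i)))))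
          ≈⟨ InPoly.•-inverse _ (leading*leading⁻¹ i) ⟩
        var i ++ neg (evL (Q i) (rest (suc i)))
          ≡⟨ P.cong (λ E → var i ++ neg E) rest-fuel ⟩
        var i ++ neg (evL q (rest (suc i))) ∎

    independent : AlgIndependent F v
    independent P evL-v-P≈0 k = trans (coeffWith≈coeff sortD P k) (InPoly.getN P≈0 k)
      where
      open InPoly.≈N-Reasoning
      P≈0 : P InPoly.≈N []
      P≈0 = begin
        P                          ≈⟨ InPoly.evL-var P ⟨
        evL var P                  ≈⟨ InPoly.evL-cong _ _ q-inverts-v P ⟨
        evL (λ j → evL q (v j)) P  ≈⟨ InPoly.evL-evL q v P ⟨
        evL q (evL v P)            ≈⟨ evL-resp-≈Λ q InPoly.≈N-refl (evL v P) [] (≈Λ⇒≈N evL-v-P≈0) ⟩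
        []                         ∎

open import Data.Product using (_,_)
open import Function.Bundles using (mk⇔)

theorem3p10 : ∀ {c ℓ} (F : Field c ℓ) → CharZero F →
    (lam mu : ℕ → List ℕ) → IsGradedSkewSeq lam mu →
    (u : ℕ → Λ F) → (∀ n → IsSkewE F (lam n) (mu n) (u n)) →
    ((AlgIndependent F (λ i → u (suc i)) × Generates F (λ i → u (suc i)))
      ⇔ (∀ n → n ≥ 1 → largest (lam n) ≥ n))
theorem3p10 F char0 lam mu graded u u-skew =
  mk⇔ (λ (_ , gen) → generating⇒largest≥ gen)
      (λ large → independent large , generates large)
  where open Generators F char0 lam mu graded u u-skew
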